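{- Let $n \ge 3$ be an integer and consider the system $A + B = C$, $ABC = D^n$ in positive integers $A,B,C,D$. If $n \not\equiv 0 \pmod 3$, the system has infinitely many positive integer solutions $(A,B,C,D)$. If $n \equiv 0 \pmod 3$, the system has no positive integer solutions. -}

module Defs where

open import Data.Nat using (ℕ; _+_; _*_; _^_; _<_; _≤_)
open import Data.Product using (_×_; ∃-syntax)
open import Relation.Binary.PropositionalEquality using (_≡_)

IsSolution : ℕ → ℕ → ℕ → ℕ → ℕ → Set
IsSolution n A B C D =
  (0 < A) × (0 < B) × (0 < C) × (0 < D) ×
  (A + B ≡ C) × (A * B * C ≡ D ^ n)

-- "infinitely many solutions": since only finitely many quadruples of
-- naturals have bounded component sum, the solution set is infinite iff
-- there are solutions of arbitrarily large size A + B + C + D.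
InfinitelyManySolutions : ℕ → Set
InfinitelyManySolutions n =
  ∀ (N : ℕ) → ∃[ A ] ∃[ B ] ∃[ C ] ∃[ D ]
    (N < A + B + C + D × IsSolution n A B C D)

-- For n ≢ 0 (mod 3) choose k, m with 3k + 1 = mn and m as large as we like: then
-- 2^k + 2^k = 2^(k+1) and 2^k · 2^k · 2^(k+1) = 2^(3k+1) = (2^m)^n.
--
-- For n = 3k a solution gives A + B = C with ABC = E³, E = D^k. Dividing A and B by their
-- gcd d (d³ ∣ E³ forces d ∣ E) leaves pairwise coprime a, b, −(a + b) whose product is a
-- cube, so each of them is a cube: a nontrivial primitive solution of x³ + y³ + z³ = 0.
-- These are ruled out by Euler's descent. With x, y odd write x = u + v, y = u − v, so that
-- 2u(u² + 3v²) = (−z)³ where 2u and u² + 3v² are coprime (if 3 ∣ u, take 6u and v² + 3(u/3)²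
-- instead), hence both cubes. In the Euclidean domain ℤ[ω], u² + 3v² = α ᾱ with α = u + v√−3
-- and α, ᾱ coprime, so α is a unit times a cube; a parity argument makes it a cube
-- (a + b√−3)³, i.e. u = a(a − 3b)(a + 3b) and v = 3b(a² − b²). The three linear factors of 2u
-- (resp. of 2u/9) are then pairwise coprime cubes with zero sum: a smaller primitive solution.

module Submission where

open import Algebra.Bundles using (CommutativeRing)
open import Algebra.Core using (Op₁; Op₂)
open import Algebra.Structures using (IsCommutativeRing)
open import Data.Empty using (⊥; ⊥-elim)
open import Data.Maybe using (just; nothing)
open import Data.Nat as ℕ using (ℕ; zero; suc; _<_; _≤_; _%_; _/_; _^_; s≤s; z≤n)
open import Data.Nat.DivMod using (m≡m%n+[m/n]*n; m%n<n)
open import Data.Nat.Induction using (<-wellFounded)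
import Data.Nat.Properties as ℕ
import Data.Nat.Tactic.RingSolver as ℕ-solve
open import Data.Product using (∃; ∃₂; _×_; _,_; proj₁; proj₂)
import Data.Sign.Properties as Sign
open import Data.Sum using (_⊎_; inj₁; inj₂)
open import Function using (_∘_)
open import Induction.WellFounded using (Acc; acc)
open import Level using (0ℓ)
open import Relation.Binary.PropositionalEquality
open import Relation.Nullary using (¬_; Dec; yes; no)
import Tactic.RingSolver as RingSolver
import Tactic.RingSolver.Core.AlmostCommutativeRing as ACR

open import Defs

open ≡-Reasoning

module Coprimality
  {A : Set} {add mul : Op₂ A} {neg : Op₁ A} {0ᴬ 1ᴬ : A}
  (isCommutativeRing : IsCommutativeRing _≡_ add mul neg 0ᴬ 1ᴬ) where

  commutativeRing : CommutativeRing 0ℓ 0ℓ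
  commutativeRing = record { isCommutativeRing = isCommutativeRing }

  open CommutativeRing commutativeRing
    using (_+_; _*_; -_; 0#; 1#; +-comm; *-comm; *-assoc; *-identityˡ; *-identityʳ;
           zeroˡ; zeroʳ; +-identityˡ; +-identityʳ; -‿inverseʳ; distribʳ; commutativeSemiring; ring; distribˡ; +-group)
  open import Algebra.Properties.Semiring.Divisibility (CommutativeRing.semiring commutativeRing)
    public using (_∣_; _,_; ∣ʳ-refl; ∣ʳ-trans; x∣ʳy⇒x∣ʳzy; _∣0)
  open import Algebra.Properties.Ring ring using (-‿distribˡ-*; -‿distribʳ-*)
  open import Algebra.Properties.Group +-group using (//-rightDividesʳ; x∙y⁻¹≈ε⇒x≈y)
  open import Algebra.Solver.Ring.NaturalCoefficients.Default commutativeSemiring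

  infix 10 _³
  _³ : A → A
  x ³ = x * x * x

  Coprime : A → A → Set
  Coprime x y = ∃₂ λ l m → l * x + m * y ≡ 1#

  Coprime-sym : ∀ {x y} → Coprime x y → Coprime y x
  Coprime-sym (l , m , e) = m , l , trans (+-comm _ _) e

  Coprime-*ʳ : ∀ {x y z} → Coprime x y → Coprime x z → Coprime x (y * z)
  Coprime-*ʳ {x} {y} {z} (l , m , e) (l′ , m′ , e′) = l * l′ * x + l * m′ * z + m * y * l′ , m * m′ , (begin
    (l * l′ * x + l * m′ * z + m * y * l′) * x + m * m′ * (y * z)
      ≡⟨ solve 7 (λ l m l′ m′ x y z → (l :* l′ :* x :+ l :* m′ :* z :+ m :* y :* l′) :* x :+ m :* m′ :* (y :* z)
                                      := (l :* x :+ m :* y) :* (l′ :* x :+ m′ :* z)) refl l m l′ m′ x y z ⟩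
    (l * x + m * y) * (l′ * x + m′ * z)   ≡⟨ cong₂ _*_ e e′ ⟩
    1# * 1#                               ≡⟨ *-identityˡ 1# ⟩
    1#                                    ∎)

  Coprime-∣ʳ : ∀ {x y z} → z ∣ y → Coprime x y → Coprime x z
  Coprime-∣ʳ {x} {y} {z} (q , qz≡y) (l , m , e) = l , m * q , (begin
    l * x + m * q * z    ≡⟨ cong (l * x +_) (trans (*-assoc m q z) (cong (m *_) qz≡y)) ⟩
    l * x + m * y        ≡⟨ e ⟩
    1#                   ∎)

  Coprime-+*ʳ : ∀ {x y z} k → z ≡ y + k * x → Coprime x y → Coprime x z
  Coprime-+*ʳ {x} {y} {z} k z≡y+kx (l , m , e) = l + - (m * k) , m , (begin
    (l + - (m * k)) * x + m * z              ≡⟨ cong ((l + - (m * k)) * x +_) (cong (m *_) z≡y+kx) ⟩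
    (l + - (m * k)) * x + m * (y + k * x)
      ≡⟨ solve 6 (λ l n m k x y → (l :+ n) :* x :+ m :* (y :+ k :* x) := (l :* x :+ m :* y) :+ (m :* k :+ n) :* x)
               refl l (- (m * k)) m k x y ⟩
    (l * x + m * y) + (m * k + - (m * k)) * x ≡⟨ cong₂ (λ s t → s + t * x) e (-‿inverseʳ (m * k)) ⟩
    1# + 0# * x                               ≡⟨ cong (1# +_) (zeroˡ x) ⟩
    1# + 0#                                   ≡⟨ +-identityʳ 1# ⟩
    1#                                        ∎)

  unit⇒Coprime : ∀ {u} x → u ∣ 1# → Coprime u x
  unit⇒Coprime {u} x (v , vu≡1) = v , 0# , trans (cong (v * u +_) (zeroˡ x)) (trans (+-identityʳ _) vu≡1)

  Coprime∧∣⇒unit : ∀ {x y} → Coprime x y → x ∣ y → x ∣ 1#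
  Coprime∧∣⇒unit {x} {y} (l , m , e) (q , qx≡y) = l + m * q , (begin
    (l + m * q) * x      ≡⟨ solve 4 (λ l m q x → (l :+ m :* q) :* x := l :* x :+ m :* (q :* x)) refl l m q x ⟩
    l * x + m * (q * x)  ≡⟨ cong (λ t → l * x + m * t) qx≡y ⟩
    l * x + m * y        ≡⟨ e ⟩
    1#                   ∎)

  coprime-divisor : ∀ {x y z} → Coprime x y → x ∣ y * z → x ∣ z
  coprime-divisor {x} {y} {z} (l , m , e) (q , qx≡yz) = l * z + m * q , (begin
    (l * z + m * q) * x        ≡⟨ solve 5 (λ l z m q x → (l :* z :+ m :* q) :* x := l :* z :* x :+ m :* (q :* x)) refl l z m q x ⟩
    l * z * x + m * (q * x)    ≡⟨ cong (λ t → l * z * x + m * t) qx≡yz ⟩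
    l * z * x + m * (y * z)    ≡⟨ solve 5 (λ l z m x y → l :* z :* x :+ m :* (y :* z) := (l :* x :+ m :* y) :* z) refl l z m x y ⟩
    (l * x + m * y) * z        ≡⟨ cong (_* z) e ⟩
    1# * z                     ≡⟨ *-identityˡ z ⟩
    z                          ∎)

  Coprime-combination : ∀ {x y c} l m → l * x + m * y ≡ c → Coprime c (x * y) → Coprime x y
  Coprime-combination {x} {y} {c} l m lx+my≡c (p , q , e) = p * l + q * y , p * m , (begin
    (p * l + q * y) * x + p * m * y
      ≡⟨ solve 7 (λ p l q y x m c → (p :* l :+ q :* y) :* x :+ p :* m :* y := p :* (l :* x :+ m :* y) :+ q :* (x :* y))
               refl p l q y x m c ⟩
    p * (l * x + m * y) + q * (x * y)  ≡⟨ cong (λ t → p * t + q * (x * y)) lx+my≡c ⟩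
    p * c + q * (x * y)                ≡⟨ e ⟩
    1#                                 ∎)

  ∣-+ : ∀ {d x y} → d ∣ x → d ∣ y → d ∣ x + y
  ∣-+ {d} (p , pd≡x) (q , qd≡y) = p + q , trans (distribʳ d p q) (cong₂ _+_ pd≡x qd≡y)

  Coprime-³ʳ : ∀ {x y} → Coprime x y → Coprime x (y ³)
  Coprime-³ʳ x⊥y = Coprime-*ʳ (Coprime-*ʳ x⊥y x⊥y) x⊥y

  *-³ : ∀ x y → (x * y) ³ ≡ x ³ * y ³
  *-³ = solve 2 (λ x y → (x :* y) :* (x :* y) :* (x :* y) := (x :* x :* x) :* (y :* y :* y)) refl

  cube-of-common-divisor : ∀ {α β γ d} → Coprime α β → α * β ≡ γ ³ → d ∣ α → d ∣ γ → d ³ ∣ α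
  cube-of-common-divisor {α} {β} {γ} {d} α⊥β αβ≡γ³ d∣α (g , gd≡γ) =
    coprime-divisor (Coprime-sym (Coprime-³ʳ (Coprime-∣ʳ d∣α (Coprime-sym α⊥β)))) (g ³ , (begin
      g ³ * d ³   ≡⟨ sym (*-³ g d) ⟩
      (g * d) ³   ≡⟨ cong _³ gd≡γ ⟩
      γ ³         ≡⟨ sym αβ≡γ³ ⟩
      α * β       ≡⟨ *-comm α β ⟩
      β * α       ∎))

  UnitTimesCube : A → Set
  UnitTimesCube α = ∃₂ λ u δ → u ∣ 1# × α ≡ u * δ ³

  unit-times-cube : ∀ {α} → α ∣ 1# → UnitTimesCube α
  unit-times-cube {α} α∣1 = α , 1# , α∣1 , sym (trans (cong (α *_) 1³≡1) (*-identityʳ α))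
    where
    1³≡1 : 1# ³ ≡ 1#
    1³≡1 = trans (cong (_* 1#) (*-identityˡ 1#)) (*-identityˡ 1#)

  module Euclidean
    (N : A → ℕ)
    (N-* : ∀ x y → N (x * y) ≡ N x ℕ.* N y)
    (N-0 : N 0# ≡ 0)
    (N≡0⇒≡0 : ∀ {x} → N x ≡ 0 → x ≡ 0#)
    (divMod : ∀ x y → y ≢ 0# → ∃₂ λ q r → x ≡ r + q * y × N r < N y)
    where

    _≟0 : ∀ x → Dec (x ≡ 0#)
    x ≟0 with N x ℕ.≟ 0
    ... | yes Nx≡0 = yes (N≡0⇒≡0 Nx≡0)
    ... | no Nx≢0  = no (λ x≡0 → Nx≢0 (trans (cong N x≡0) N-0))

    zero-product : ∀ x y → x * y ≡ 0# → x ≡ 0# ⊎ y ≡ 0#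
    zero-product x y xy≡0 with ℕ.m*n≡0⇒m≡0∨n≡0 (N x) (trans (sym (N-* x y)) (trans (cong N xy≡0) N-0))
    ... | inj₁ Nx≡0 = inj₁ (N≡0⇒≡0 Nx≡0)
    ... | inj₂ Ny≡0 = inj₂ (N≡0⇒≡0 Ny≡0)

    *-≢0 : ∀ {x y} → x ≢ 0# → y ≢ 0# → x * y ≢ 0#
    *-≢0 {x} {y} x≢0 y≢0 xy≡0 with zero-product x y xy≡0
    ... | inj₁ x≡0 = x≢0 x≡0
    ... | inj₂ y≡0 = y≢0 y≡0

    ³-≢0 : ∀ {x} → x ≢ 0# → x ³ ≢ 0#
    ³-≢0 x≢0 = *-≢0 (*-≢0 x≢0 x≢0) x≢0

    *-cancelˡ : ∀ {x y z} → x ≢ 0# → x * y ≡ x * z → y ≡ z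
    *-cancelˡ {x} {y} {z} x≢0 xy≡xz with zero-product x (y + - z) (begin
      x * (y + - z)       ≡⟨ distribˡ x y (- z) ⟩
      x * y + x * - z     ≡⟨ cong₂ _+_ xy≡xz (sym (-‿distribʳ-* x z)) ⟩
      x * z + - (x * z)   ≡⟨ -‿inverseʳ (x * z) ⟩
      0#                  ∎)
    ... | inj₁ x≡0   = ⊥-elim (x≢0 x≡0)
    ... | inj₂ y-z≡0 = x∙y⁻¹≈ε⇒x≈y y z y-z≡0

    N≡1⇒unit : ∀ {u} → N u ≡ 1 → u ∣ 1#
    N≡1⇒unit {u} Nu≡1 with divMod 1# u (λ u≡0 → ℕ.0≢1+n (trans (sym N-0) (trans (cong N (sym u≡0)) Nu≡1)))
    ... | q , r , 1≡r+qu , Nr<Nu = q , sym (begin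
      1#          ≡⟨ 1≡r+qu ⟩
      r + q * u   ≡⟨ cong (_+ q * u) (N≡0⇒≡0 (ℕ.n<1⇒n≡0 (subst (N r <_) Nu≡1 Nr<Nu))) ⟩
      0# + q * u  ≡⟨ +-identityˡ (q * u) ⟩
      q * u       ∎)

    record Gcd (x y : A) : Set where
      field
        gcd    : A
        gcd∣x  : gcd ∣ x
        gcd∣y  : gcd ∣ y
        l m    : A
        bézout : gcd ≡ l * x + m * y

    remainder : ∀ {x y q r} → x ≡ r + q * y → r ≡ x + - q * y
    remainder {x} {y} {q} {r} x≡r+qy = begin
      r                    ≡⟨ sym (//-rightDividesʳ (q * y) r) ⟩
      r + q * y + - (q * y) ≡⟨ cong₂ _+_ (sym x≡r+qy) (-‿distribˡ-* q y) ⟩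
      x + - q * y          ∎

    gcd : ∀ x y → Gcd x y
    gcd x y = go x y (<-wellFounded (N y))
      where
      go : ∀ x y → Acc _<_ (N y) → Gcd x y
      go x y (acc rec) with y ≟0
      ... | yes refl = record
        { gcd = x ; gcd∣x = ∣ʳ-refl ; gcd∣y = x ∣0 ; l = 1# ; m = 0#
        ; bézout = sym (trans (cong₂ _+_ (*-identityˡ x) (zeroˡ 0#)) (+-identityʳ x)) }
      ... | no y≢0 with divMod x y y≢0
      ...   | q , r , x≡r+qy , Nr<Ny with go y r (rec Nr<Ny)
      ...     | record { gcd = d ; gcd∣x = d∣y ; gcd∣y = d∣r ; l = l ; m = m ; bézout = d≡ly+mr } = record
        { gcd = d
        ; gcd∣x = subst (d ∣_) (sym x≡r+qy) (∣-+ d∣r (x∣ʳy⇒x∣ʳzy q d∣y))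
        ; gcd∣y = d∣y
        ; l = m
        ; m = l + m * - q
        ; bézout = begin
            d                          ≡⟨ d≡ly+mr ⟩
            l * y + m * r              ≡⟨ cong (λ t → l * y + m * t) (remainder x≡r+qy) ⟩
            l * y + m * (x + - q * y)
              ≡⟨ solve 5 (λ l y m x q′ → l :* y :+ m :* (x :+ q′ :* y) := m :* x :+ (l :+ m :* q′) :* y) refl l y m x (- q) ⟩
            m * x + (l + m * - q) * y  ∎
        }

    Coprime-cofactors : ∀ {d a b} l m → d ≢ 0# → d ≡ l * (a * d) + m * (b * d) → Coprime a b
    Coprime-cofactors {d} {a} {b} l m d≢0 d≡ladp+mbd = l , m , *-cancelˡ d≢0 (begin
      d * (l * a + m * b)       ≡⟨ solve 5 (λ d l a m b → d :* (l :* a :+ m :* b) := l :* (a :* d) :+ m :* (b :* d)) refl d l a m b ⟩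
      l * (a * d) + m * (b * d) ≡⟨ sym d≡ladp+mbd ⟩
      d                         ≡⟨ sym (*-identityʳ d) ⟩
      d * 1#                    ∎)

    N-<-* : ∀ {x y} → x ≢ 0# → 2 ≤ N y → N x < N (x * y)
    N-<-* {x} {y} x≢0 2≤Ny = subst (N x <_) (sym (N-* x y))
      (ℕ.m<m*n (N x) (N y) {{ℕ.≢-nonZero (x≢0 ∘ N≡0⇒≡0)}} 2≤Ny)

    cancel-common-cube : ∀ {α β d g} → d ≢ 0# → Coprime α β → α * β ≡ (g * d) ³ → d ∣ α →
                         ∃ λ α′ → α′ * d ³ ≡ α × Coprime α′ β × α′ * β ≡ g ³
    cancel-common-cube {α} {β} {d} {g} d≢0 α⊥β αβ≡gd³ d∣α = cancel (cube-of-common-divisor α⊥β αβ≡gd³ d∣α (g , refl))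
      where
      cancel : d ³ ∣ α → ∃ λ α′ → α′ * d ³ ≡ α × Coprime α′ β × α′ * β ≡ g ³
      cancel (α′ , α′d³≡α) = α′ , α′d³≡α , α′⊥β , *-cancelˡ (³-≢0 d≢0) (begin
        d ³ * (α′ * β)   ≡⟨ solve 3 (λ d a b → (d :* d :* d) :* (a :* b) := (a :* (d :* d :* d)) :* b) refl d α′ β ⟩
        α′ * d ³ * β     ≡⟨ cong (_* β) α′d³≡α ⟩
        α * β            ≡⟨ αβ≡gd³ ⟩
        (g * d) ³        ≡⟨ trans (*-³ g d) (*-comm (g ³) (d ³)) ⟩
        d ³ * g ³        ∎)
        where
        α′⊥β : Coprime α′ β
        α′⊥β = Coprime-sym (Coprime-∣ʳ (d ³ , trans (*-comm (d ³) α′) α′d³≡α) (Coprime-sym α⊥β))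

    factor-of-zero : ∀ {α β} → Coprime α β → α * β ≡ 0# → UnitTimesCube α
    factor-of-zero {α} {β} α⊥β αβ≡0 with zero-product α β αβ≡0
    ... | inj₁ α≡0 = 1# , 0# , ∣ʳ-refl , trans α≡0 (sym (trans (*-identityˡ _) (zeroʳ (0# * 0#))))
    ... | inj₂ β≡0 = unit-times-cube (Coprime∧∣⇒unit α⊥β (subst (α ∣_) (sym β≡0) (α ∣0)))

    coprime-factor-of-cube : ∀ {α β γ} → Coprime α β → α * β ≡ γ ³ → UnitTimesCube α
    coprime-factor-of-cube {β = β} {γ} = go γ (<-wellFounded (N γ))
      where
      go : ∀ {α} γ → Acc _<_ (N γ) → Coprime α β → α * β ≡ γ ³ → UnitTimesCube α
      go {α} γ (acc rec) α⊥β αβ≡γ³ with γ ≟0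
      ... | yes refl = factor-of-zero α⊥β (trans αβ≡γ³ (zeroʳ (0# * 0#)))
      ... | no γ≢0 = from-gcd (gcd α γ)
        where
        from-gcd : Gcd α γ → UnitTimesCube α
        from-gcd record { gcd = d ; gcd∣x = d∣α ; gcd∣y = g , refl ; l = l ; m = m ; bézout = d≡lα+mγ } =
          by-norm (N d) refl
          where
          by-norm : ∀ n → N d ≡ n → UnitTimesCube α
          by-norm 0 Nd≡0 = ⊥-elim (γ≢0 (trans (cong (g *_) (N≡0⇒≡0 Nd≡0)) (zeroʳ g)))
          by-norm 1 Nd≡1 = unit-times-cube (Coprime∧∣⇒unit
            (Coprime-³ʳ (Coprime-combination l m (sym d≡lα+mγ) (unit⇒Coprime _ (N≡1⇒unit Nd≡1))))
            (β , trans (*-comm β α) αβ≡γ³))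
          by-norm (suc (suc k)) Nd≡n = descend (cancel-common-cube d≢0 α⊥β αβ≡γ³ d∣α)
            where
            d≢0 : d ≢ 0#
            d≢0 d≡0 = ℕ.0≢1+n (trans (sym N-0) (trans (cong N (sym d≡0)) Nd≡n))
            g≢0 : g ≢ 0#
            g≢0 g≡0 = γ≢0 (trans (cong (_* d) g≡0) (zeroˡ d))
            descend : (∃ λ α′ → α′ * d ³ ≡ α × Coprime α′ β × α′ * β ≡ g ³) → UnitTimesCube α
            descend (α′ , α′d³≡α , α′⊥β , α′β≡g³)
              with go g (rec (N-<-* g≢0 (subst (2 ≤_) (sym Nd≡n) (s≤s (s≤s z≤n))))) α′⊥β α′β≡g³
            ... | u , δ , u∣1 , α′≡uδ³ = u , δ * d , u∣1 , (begin
              α                ≡⟨ sym α′d³≡α ⟩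
              α′ * d ³         ≡⟨ cong (_* d ³) α′≡uδ³ ⟩
              u * δ ³ * d ³    ≡⟨ trans (*-assoc u (δ ³) (d ³)) (cong (u *_) (sym (*-³ δ d))) ⟩
              u * (δ * d) ³    ∎)

    ³∣³⇒∣ : ∀ {x y} → x ³ ∣ y ³ → x ∣ y
    ³∣³⇒∣ {x} {y} x³∣y³ = from-gcd (gcd x y) x³∣y³
      where
      from-gcd : ∀ {x y} → Gcd x y → x ³ ∣ y ³ → x ∣ y
      from-gcd record { gcd = d ; gcd∣x = a , refl ; gcd∣y = b , refl ; l = l ; m = m ; bézout = d≡lad+mbd }
               (q , q[ad]³≡[bd]³) with d ≟0
      ... | yes refl = subst ((a * 0#) ∣_) (sym (zeroʳ b)) ((a * 0#) ∣0)
      ... | no d≢0 = from-unit (∣ʳ-trans (a * a , refl)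
                       (Coprime∧∣⇒unit (Coprime-³ʳ (Coprime-sym (Coprime-³ʳ (Coprime-sym a⊥b)))) (q , qa³≡b³)))
        where
        a⊥b : Coprime a b
        a⊥b = Coprime-cofactors l m d≢0 d≡lad+mbd
        qa³≡b³ : q * a ³ ≡ b ³
        qa³≡b³ = *-cancelˡ (³-≢0 d≢0) (begin
          d ³ * (q * a ³)  ≡⟨ solve 3 (λ d q a → (d :* d :* d) :* (q :* (a :* a :* a)) := q :* ((a :* d) :* (a :* d) :* (a :* d))) refl d q a ⟩
          q * (a * d) ³    ≡⟨ q[ad]³≡[bd]³ ⟩
          (b * d) ³        ≡⟨ trans (*-³ b d) (*-comm (b ³) (d ³)) ⟩
          d ³ * b ³        ∎)
        from-unit : a ∣ 1# → a * d ∣ b * d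
        from-unit (v , va≡1) = b * v , (begin
          b * v * (a * d)  ≡⟨ solve 4 (λ b v a d → b :* v :* (a :* d) := b :* (v :* a) :* d) refl b v a d ⟩
          b * (v * a) * d  ≡⟨ cong (λ t → b * t * d) va≡1 ⟩
          b * 1# * d       ≡⟨ cong (_* d) (*-identityʳ b) ⟩
          b * d            ∎)

open import Data.Integer as ℤ using (ℤ; +_; -_; 0ℤ; 1ℤ; ∣_∣; _+_; _*_; _-_)
import Data.Integer.DivMod as ℤ
import Data.Integer.Properties as ℤ
open import Data.Integer.Tactic.RingSolver using (solve-∀)

open Coprimality ℤ.+-*-isCommutativeRing

ℤ-divMod : ∀ x y → y ≢ 0ℤ → ∃₂ λ q r → x ≡ r + q * y × ∣ r ∣ < ∣ y ∣
ℤ-divMod x y y≢0 = x ℤ./ y , + (x ℤ.% y) , ℤ.a≡a%n+[a/n]*n x y , ℤ.n%d<d x y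
  where instance _ = ℤ.≢-nonZero y≢0

open Euclidean ∣_∣ ℤ.abs-* refl ℤ.∣i∣≡0⇒i≡0 ℤ-divMod

∣i∣≡1⇒i≡±1 : ∀ {i} → ∣ i ∣ ≡ 1 → i ≡ 1ℤ ⊎ i ≡ - 1ℤ
∣i∣≡1⇒i≡±1 {i} ∣i∣≡1 with ℤ.+∣i∣≡i⊎+∣i∣≡-i i
... | inj₁ ∣i∣≡i  = inj₁ (trans (sym ∣i∣≡i) (cong +_ ∣i∣≡1))
... | inj₂ ∣i∣≡-i = inj₂ (trans (sym (ℤ.neg-involutive i)) (cong -_ (trans (sym ∣i∣≡-i) (cong +_ ∣i∣≡1))))

ℤ-unit : ∀ {u} → u ∣ 1ℤ → u ≡ 1ℤ ⊎ u ≡ - 1ℤ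
ℤ-unit {u} (v , vu≡1) = ∣i∣≡1⇒i≡±1 (ℕ.m*n≡1⇒n≡1 ∣ v ∣ ∣ u ∣ (trans (sym (ℤ.abs-* v u)) (cong ∣_∣ vu≡1)))

coprime-factor-of-cubeℤ : ∀ {a b c} → Coprime a b → a * b ≡ c ³ → ∃ λ r → a ≡ r ³
coprime-factor-of-cubeℤ {c = c} a⊥b ab≡c³ with coprime-factor-of-cube {γ = c} a⊥b ab≡c³
... | u , δ , u∣1 , a≡uδ³ with ℤ-unit u∣1
...   | inj₁ refl = δ , trans a≡uδ³ (ℤ.*-identityˡ (δ ³))
...   | inj₂ refl = - δ , trans a≡uδ³ (-1*δ³ δ)
  where
  -1*δ³ : ∀ δ → - 1ℤ * (δ * δ * δ) ≡ (- δ) * (- δ) * (- δ)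
  -1*δ³ = solve-∀

-- Oddness is coprimality with 2, so parity arguments reuse the coprimality lemmas.
Even Odd : ℤ → Set
Even x = + 2 ∣ x
Odd = Coprime (+ 2)

2∤1 : ¬ (+ 2 ∣ 1ℤ)
2∤1 (q , q*2≡1) with ℕ.m*n≡1⇒n≡1 ∣ q ∣ 2 (trans (sym (ℤ.abs-* q (+ 2))) (cong ∣_∣ q*2≡1))
... | ()

Odd⇒¬Even : ∀ {x} → Odd x → ¬ Even x
Odd⇒¬Even odd 2∣x = 2∤1 (Coprime∧∣⇒unit odd 2∣x)

1+2j-odd : ∀ {x} j → x ≡ 1ℤ + j * + 2 → Odd x
1+2j-odd j x≡1+2j = Coprime-+*ʳ {y = 1ℤ} j x≡1+2j (0ℤ , 1ℤ , refl)

parity : ∀ x → Even x ⊎ ∃ λ j → x ≡ 1ℤ + j * + 2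
parity x with x ℤ.% + 2 | ℤ.a≡a%n+[a/n]*n x (+ 2) | ℤ.n%d<d x (+ 2)
... | 0 | x≡0+2q | _ = inj₁ (x ℤ./ + 2 , sym (trans x≡0+2q (ℤ.+-identityˡ _)))
... | 1 | x≡1+2q | _ = inj₂ (x ℤ./ + 2 , x≡1+2q)
... | suc (suc _) | _ | s≤s (s≤s ())

Even⊎Odd : ∀ x → Even x ⊎ Odd x
Even⊎Odd x with parity x
... | inj₁ 2∣x = inj₁ 2∣x
... | inj₂ (j , x≡1+2j) = inj₂ (1+2j-odd j x≡1+2j)

Odd⇒1+2j : ∀ {x} → Odd x → ∃ λ j → x ≡ 1ℤ + j * + 2
Odd⇒1+2j {x} odd with parity x
... | inj₁ 2∣x = ⊥-elim (Odd⇒¬Even odd 2∣x)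
... | inj₂ 1+2j = 1+2j

3∣⊎Coprime3 : ∀ x → + 3 ∣ x ⊎ Coprime (+ 3) x
3∣⊎Coprime3 x with x ℤ.% + 3 | ℤ.a≡a%n+[a/n]*n x (+ 3) | ℤ.n%d<d x (+ 3)
... | 0 | x≡0+3q | _ = inj₁ (x ℤ./ + 3 , sym (trans x≡0+3q (ℤ.+-identityˡ _)))
... | 1 | x≡1+3q | _ = inj₂ (Coprime-+*ʳ {y = 1ℤ} (x ℤ./ + 3) x≡1+3q (0ℤ , 1ℤ , refl))
... | 2 | x≡2+3q | _ = inj₂ (Coprime-+*ʳ {y = + 2} (x ℤ./ + 3) x≡2+3q (1ℤ , - 1ℤ , refl))
... | suc (suc (suc _)) | _ | s≤s (s≤s (s≤s ()))

Even-neg : ∀ {x} → Even x → Even (- x)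
Even-neg (k , k2≡x) = - k , trans (sym (ℤ.neg-distribˡ-* k (+ 2))) (cong -_ k2≡x)

pairwise-coprime-cubes : ∀ {a b c e} → Coprime a b → Coprime a c → Coprime b c → a * b * c ≡ e ³ →
                         ∃ λ p → ∃ λ q → ∃ λ r → a ≡ p ³ × b ≡ q ³ × c ≡ r ³
pairwise-coprime-cubes {a} {b} {c} {e} a⊥b a⊥c b⊥c abc≡e³ =
  proj₁ cube-a , proj₁ cube-b , proj₁ cube-c , proj₂ cube-a , proj₂ cube-b , proj₂ cube-c
  where
  cube-a : ∃ λ p → a ≡ p ³
  cube-a = coprime-factor-of-cubeℤ {c = e} (Coprime-*ʳ a⊥b a⊥c) (trans (sym (ℤ.*-assoc a b c)) abc≡e³)
  cube-b : ∃ λ q → b ≡ q ³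
  cube-b = coprime-factor-of-cubeℤ {c = e} (Coprime-*ʳ (Coprime-sym a⊥b) b⊥c) (trans (rotate a b c) abc≡e³)
    where
    rotate : ∀ a b c → b * (a * c) ≡ a * b * c
    rotate = solve-∀
  cube-c : ∃ λ r → c ≡ r ³
  cube-c = coprime-factor-of-cubeℤ {c = e} (Coprime-*ʳ (Coprime-sym a⊥c) (Coprime-sym b⊥c)) (trans (ℤ.*-comm c (a * b)) abc≡e³)

Coprime-neg : ∀ {x y} → Coprime x y → Coprime x (- y)
Coprime-neg {x} {y} = Coprime-∣ʳ (- 1ℤ , neg-neg y)
  where
  neg-neg : ∀ y → - 1ℤ * - y ≡ y
  neg-neg = solve-∀

x²+3y²-odd : ∀ s t → Odd (s + t) → Odd (s * s + + 3 * (t * t))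
x²+3y²-odd s t odd = Coprime-+*ʳ (t * t - s * t) (complete-square s t) (Coprime-*ʳ odd odd)
  where
  complete-square : ∀ s t → s * s + + 3 * (t * t) ≡ (s + t) * (s + t) + (t * t - s * t) * + 2
  complete-square = solve-∀

square-abs : ∀ i → i * i ≡ + (∣ i ∣ ℕ.* ∣ i ∣)
square-abs i = trans (cong (ℤ._◃ (∣ i ∣ ℕ.* ∣ i ∣)) (Sign.s*s≡+ (ℤ.sign i))) (ℤ.+◃n≡+n _)

x²+3y²≡+ : ∀ x y → x * x + + 3 * (y * y) ≡ + (∣ x ∣ ℕ.* ∣ x ∣ ℕ.+ 3 ℕ.* (∣ y ∣ ℕ.* ∣ y ∣))
x²+3y²≡+ x y = begin
  x * x + + 3 * (y * y)                ≡⟨ cong₂ (λ s t → s + + 3 * t) (square-abs x) (square-abs y) ⟩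
  + (∣ x ∣ ℕ.* ∣ x ∣) + + 3 * + (∣ y ∣ ℕ.* ∣ y ∣)   ≡⟨ cong (λ k → + (∣ x ∣ ℕ.* ∣ x ∣) + k) (sym (ℤ.pos-* 3 (∣ y ∣ ℕ.* ∣ y ∣))) ⟩
  + (∣ x ∣ ℕ.* ∣ x ∣) + + (3 ℕ.* (∣ y ∣ ℕ.* ∣ y ∣)) ≡⟨ sym (ℤ.pos-+ (∣ x ∣ ℕ.* ∣ x ∣) (3 ℕ.* (∣ y ∣ ℕ.* ∣ y ∣))) ⟩
  + (∣ x ∣ ℕ.* ∣ x ∣ ℕ.+ 3 ℕ.* (∣ y ∣ ℕ.* ∣ y ∣)) ∎

Odd⇒≢0 : ∀ {x} → Odd x → x ≢ 0ℤ
Odd⇒≢0 odd refl = Odd⇒¬Even odd (0ℤ , refl)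

-‿≢0 : ∀ {x} → x ≢ 0ℤ → - x ≢ 0ℤ
-‿≢0 {x} x≢0 -x≡0 = x≢0 (trans (sym (ℤ.neg-involutive x)) (cong -_ -x≡0))

-- ⟨ a , b ⟩ represents a + bω, where ω² = −1 − ω.
record ℤ[ω] : Set where
  constructor ⟨_,_⟩
  field
    re im : ℤ
open ℤ[ω]

infixl 6 _+ω_
infixl 7 _*ω_
infix 8 -ω_

_+ω_ : ℤ[ω] → ℤ[ω] → ℤ[ω]
⟨ a , b ⟩ +ω ⟨ c , d ⟩ = ⟨ a + c , b + d ⟩

_*ω_ : ℤ[ω] → ℤ[ω] → ℤ[ω]
⟨ a , b ⟩ *ω ⟨ c , d ⟩ = ⟨ a * c - b * d , a * d + b * c - b * d ⟩

-ω_ : ℤ[ω] → ℤ[ω]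
-ω ⟨ a , b ⟩ = ⟨ - a , - b ⟩

0ω 1ω ω : ℤ[ω]
0ω = ⟨ 0ℤ , 0ℤ ⟩
1ω = ⟨ 1ℤ , 0ℤ ⟩
ω  = ⟨ 0ℤ , 1ℤ ⟩

private
  *-assoc-re : ∀ a b c d e f → (a * c - b * d) * e - (a * d + b * c - b * d) * f
                              ≡ a * (c * e - d * f) - b * (c * f + d * e - d * f)
  *-assoc-re = solve-∀
  *-assoc-im : ∀ a b c d e f → (a * c - b * d) * f + (a * d + b * c - b * d) * e - (a * d + b * c - b * d) * f
                              ≡ a * (c * f + d * e - d * f) + b * (c * e - d * f) - b * (c * f + d * e - d * f)
  *-assoc-im = solve-∀
  *-identityˡ-re : ∀ a b → 1ℤ * a - 0ℤ * b ≡ a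
  *-identityˡ-re = solve-∀
  *-identityˡ-im : ∀ a b → 1ℤ * b + 0ℤ * a - 0ℤ * b ≡ b
  *-identityˡ-im = solve-∀
  *-identityʳ-re : ∀ a b → a * 1ℤ - b * 0ℤ ≡ a
  *-identityʳ-re = solve-∀
  *-identityʳ-im : ∀ a b → a * 0ℤ + b * 1ℤ - b * 0ℤ ≡ b
  *-identityʳ-im = solve-∀
  distribˡ-re : ∀ a b c d e f → a * (c + e) - b * (d + f) ≡ (a * c - b * d) + (a * e - b * f)
  distribˡ-re = solve-∀
  distribˡ-im : ∀ a b c d e f → a * (d + f) + b * (c + e) - b * (d + f) ≡ (a * d + b * c - b * d) + (a * f + b * e - b * f)
  distribˡ-im = solve-∀
  distribʳ-re : ∀ a b c d e f → (c + e) * a - (d + f) * b ≡ (c * a - d * b) + (e * a - f * b)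
  distribʳ-re = solve-∀
  distribʳ-im : ∀ a b c d e f → (c + e) * b + (d + f) * a - (d + f) * b ≡ (c * b + d * a - d * b) + (e * b + f * a - f * b)
  distribʳ-im = solve-∀
  *-comm-re : ∀ a b c d → a * c - b * d ≡ c * a - d * b
  *-comm-re = solve-∀
  *-comm-im : ∀ a b c d → a * d + b * c - b * d ≡ c * b + d * a - d * b
  *-comm-im = solve-∀

ℤ[ω]-isCommutativeRing : IsCommutativeRing _≡_ _+ω_ _*ω_ -ω_ 0ω 1ω
ℤ[ω]-isCommutativeRing = record
  { isRing = record
    { +-isAbelianGroup = record
      { isGroup = record
        { isMonoid = record
          { isSemigroup = record
            { isMagma = record { isEquivalence = isEquivalence ; ∙-cong = cong₂ _+ω_ }
            ; assoc = λ { ⟨ a , b ⟩ ⟨ c , d ⟩ ⟨ e , f ⟩ → cong₂ ⟨_,_⟩ (ℤ.+-assoc a c e) (ℤ.+-assoc b d f) } }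
          ; identity = (λ { ⟨ a , b ⟩ → cong₂ ⟨_,_⟩ (ℤ.+-identityˡ a) (ℤ.+-identityˡ b) })
                     , (λ { ⟨ a , b ⟩ → cong₂ ⟨_,_⟩ (ℤ.+-identityʳ a) (ℤ.+-identityʳ b) }) }
        ; inverse = (λ { ⟨ a , b ⟩ → cong₂ ⟨_,_⟩ (ℤ.+-inverseˡ a) (ℤ.+-inverseˡ b) })
                  , (λ { ⟨ a , b ⟩ → cong₂ ⟨_,_⟩ (ℤ.+-inverseʳ a) (ℤ.+-inverseʳ b) })
        ; ⁻¹-cong = cong -ω_ }
      ; comm = λ { ⟨ a , b ⟩ ⟨ c , d ⟩ → cong₂ ⟨_,_⟩ (ℤ.+-comm a c) (ℤ.+-comm b d) } }
    ; *-cong = cong₂ _*ω_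
    ; *-assoc = λ { ⟨ a , b ⟩ ⟨ c , d ⟩ ⟨ e , f ⟩ → cong₂ ⟨_,_⟩ (*-assoc-re a b c d e f) (*-assoc-im a b c d e f) }
    ; *-identity = (λ { ⟨ a , b ⟩ → cong₂ ⟨_,_⟩ (*-identityˡ-re a b) (*-identityˡ-im a b) })
                 , (λ { ⟨ a , b ⟩ → cong₂ ⟨_,_⟩ (*-identityʳ-re a b) (*-identityʳ-im a b) })
    ; distrib = (λ { ⟨ a , b ⟩ ⟨ c , d ⟩ ⟨ e , f ⟩ → cong₂ ⟨_,_⟩ (distribˡ-re a b c d e f) (distribˡ-im a b c d e f) })
              , (λ { ⟨ a , b ⟩ ⟨ c , d ⟩ ⟨ e , f ⟩ → cong₂ ⟨_,_⟩ (distribʳ-re a b c d e f) (distribʳ-im a b c d e f) }) }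
  ; *-comm = λ { ⟨ a , b ⟩ ⟨ c , d ⟩ → cong₂ ⟨_,_⟩ (*-comm-re a b c d) (*-comm-im a b c d) } }

ι : ℤ → ℤ[ω]
ι a = ⟨ a , 0ℤ ⟩

conj : ℤ[ω] → ℤ[ω]
conj ⟨ a , b ⟩ = ⟨ a - b , - b ⟩

norm : ℤ[ω] → ℤ
norm ⟨ a , b ⟩ = a * a - a * b + b * b

Nω : ℤ[ω] → ℕ
Nω x = ∣ norm x ∣


4norm≡ : ∀ a b → + 4 * norm ⟨ a , b ⟩ ≡ + (∣ + 2 * a - b ∣ ℕ.* ∣ + 2 * a - b ∣ ℕ.+ 3 ℕ.* (∣ b ∣ ℕ.* ∣ b ∣))
4norm≡ a b = trans (4norm a b) (x²+3y²≡+ (+ 2 * a - b) b)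
  where
  4norm : ∀ a b → + 4 * (a * a - a * b + b * b) ≡ (+ 2 * a - b) * (+ 2 * a - b) + + 3 * (b * b)
  4norm = solve-∀

4Nω≡ : ∀ a b → 4 ℕ.* Nω ⟨ a , b ⟩ ≡ ∣ + 2 * a - b ∣ ℕ.* ∣ + 2 * a - b ∣ ℕ.+ 3 ℕ.* (∣ b ∣ ℕ.* ∣ b ∣)
4Nω≡ a b = trans (sym (ℤ.abs-* (+ 4) (norm ⟨ a , b ⟩))) (cong ∣_∣ (4norm≡ a b))

+Nω≡norm : ∀ x → + Nω x ≡ norm x
+Nω≡norm x@(⟨ a , b ⟩) =
  ℤ.0≤i⇒+∣i∣≡i (ℤ.*-cancelˡ-≤-pos 0ℤ (norm x) (+ 4) (subst (0ℤ ℤ.≤_) (sym (4norm≡ a b)) (ℤ.+≤+ z≤n)))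

Nω-* : ∀ x y → Nω (x *ω y) ≡ Nω x ℕ.* Nω y
Nω-* ⟨ a , b ⟩ ⟨ c , d ⟩ = trans (cong ∣_∣ (norm-* a b c d)) (ℤ.abs-* (norm ⟨ a , b ⟩) (norm ⟨ c , d ⟩))
  where
  norm-* : ∀ a b c d → (a * c - b * d) * (a * c - b * d) - (a * c - b * d) * (a * d + b * c - b * d)
                         + (a * d + b * c - b * d) * (a * d + b * c - b * d)
                       ≡ (a * a - a * b + b * b) * (c * c - c * d + d * d)
  norm-* = solve-∀

Nω⟨a,0⟩ : ∀ a → Nω ⟨ a , 0ℤ ⟩ ≡ ∣ a ∣ ℕ.* ∣ a ∣
Nω⟨a,0⟩ a = trans (cong ∣_∣ (norm⟨a,0⟩ a)) (ℤ.abs-* a a)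
  where
  norm⟨a,0⟩ : ∀ a → a * a - a * 0ℤ + 0ℤ * 0ℤ ≡ a * a
  norm⟨a,0⟩ = solve-∀

square≡0 : ∀ n → n ℕ.* n ≡ 0 → n ≡ 0
square≡0 n n²≡0 with ℕ.m*n≡0⇒m≡0∨n≡0 n n²≡0
... | inj₁ n≡0 = n≡0
... | inj₂ n≡0 = n≡0

Nω≡0⇒≡0 : ∀ {x} → Nω x ≡ 0 → x ≡ 0ω
Nω≡0⇒≡0 {⟨ a , b ⟩} Nx≡0 = cong₂ ⟨_,_⟩ a≡0 b≡0
  where
  b≡0 : b ≡ 0ℤ
  b≡0 = ℤ.∣i∣≡0⇒i≡0 (square≡0 ∣ b ∣ (ℕ.m*n≡0⇒m≡0 (∣ b ∣ ℕ.* ∣ b ∣) 3 (trans (ℕ.*-comm (∣ b ∣ ℕ.* ∣ b ∣) 3)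
          (ℕ.m+n≡0⇒n≡0 (∣ + 2 * a - b ∣ ℕ.* ∣ + 2 * a - b ∣) (trans (sym (4Nω≡ a b)) (cong (4 ℕ.*_) Nx≡0))))))
  a≡0 : a ≡ 0ℤ
  a≡0 = ℤ.∣i∣≡0⇒i≡0 (square≡0 ∣ a ∣ (trans (sym (Nω⟨a,0⟩ a)) (subst (λ b → Nω ⟨ a , b ⟩ ≡ 0) b≡0 Nx≡0)))

round : ∀ x n .{{_ : ℕ.NonZero n}} → ∃₂ λ q r → x ≡ r + q * + n × 2 ℕ.* ∣ r ∣ ≤ n
round x n with 2 ℕ.* (x ℤ.%ℕ n) ℕ.≤? n
... | yes small = x ℤ./ℕ n , + (x ℤ.%ℕ n) , ℤ.a≡a%ℕn+[a/ℕn]*n x n , small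
... | no large = x ℤ./ℕ n ℤ.+ 1ℤ , - + s , x≡ , s-small
  where
  r s : ℕ
  r = x ℤ.%ℕ n
  s = n ℕ.∸ r
  s+r≡n : s ℕ.+ r ≡ n
  s+r≡n = ℕ.m∸n+n≡m (ℕ.<⇒≤ (ℤ.n%ℕd<d x n))
  x≡ : x ≡ - + s + (x ℤ./ℕ n ℤ.+ 1ℤ) * + n
  x≡ = begin
    x                                   ≡⟨ ℤ.a≡a%ℕn+[a/ℕn]*n x n ⟩
    + r + x ℤ./ℕ n * + n                ≡⟨ cong (λ m → + r + x ℤ./ℕ n * m) (trans (cong +_ (sym s+r≡n)) (ℤ.pos-+ s r)) ⟩
    + r + x ℤ./ℕ n * (+ s + + r)        ≡⟨ shift (+ r) (x ℤ./ℕ n) (+ s) ⟩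
    - + s + (x ℤ./ℕ n + 1ℤ) * (+ s + + r) ≡⟨ cong (λ m → - + s + (x ℤ./ℕ n + 1ℤ) * m) (trans (sym (ℤ.pos-+ s r)) (cong +_ s+r≡n)) ⟩
    - + s + (x ℤ./ℕ n + 1ℤ) * + n       ∎
    where
    shift : ∀ r q s → r + q * (s + r) ≡ - s + (q + 1ℤ) * (s + r)
    shift = solve-∀
  s-small : 2 ℕ.* ∣ - + s ∣ ≤ n
  s-small = subst (_≤ n) (sym (trans (cong (2 ℕ.*_) (ℤ.∣-i∣≡∣i∣ (+ s))) (ℕ.*-distribˡ-∸ 2 n r)))
    (ℕ.≤-trans (ℕ.∸-monoʳ-≤ (2 ℕ.* n) (ℕ.<⇒≤ (ℕ.≰⇒> large))) (ℕ.≤-reflexive (2n∸n≡n n)))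
    where
    2n∸n≡n : ∀ n → 2 ℕ.* n ℕ.∸ n ≡ n
    2n∸n≡n n = trans (cong (ℕ._∸ n) (ℕ.+-comm n (n ℕ.+ 0))) (trans (ℕ.m+n∸n≡m (n ℕ.+ 0) n) (ℕ.+-identityʳ n))

Nω-small : ∀ a b n → 2 ℕ.* ∣ a ∣ ≤ n → 2 ℕ.* ∣ b ∣ ≤ n → .{{_ : ℕ.NonZero n}} → Nω ⟨ a , b ⟩ < n ℕ.* n
Nω-small a b n 2∣a∣≤n 2∣b∣≤n = ℕ.*-cancelˡ-< 16 (Nω ⟨ a , b ⟩) (n ℕ.* n) (ℕ.≤-<-trans 16N≤12n² 12n²<16n²)
  where
  2n+n≡3n : ∀ n → 2 ℕ.* n ℕ.+ n ≡ 3 ℕ.* n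
  2n+n≡3n = ℕ-solve.solve-∀
  doubling : ∀ s t → 4 ℕ.* (s ℕ.* s ℕ.+ 3 ℕ.* (t ℕ.* t)) ≡ 2 ℕ.* s ℕ.* (2 ℕ.* s) ℕ.+ 3 ℕ.* (2 ℕ.* t ℕ.* (2 ℕ.* t))
  doubling = ℕ-solve.solve-∀
  nine-plus-three : ∀ n → 3 ℕ.* n ℕ.* (3 ℕ.* n) ℕ.+ 3 ℕ.* (n ℕ.* n) ≡ 12 ℕ.* (n ℕ.* n)
  nine-plus-three = ℕ-solve.solve-∀
  s t : ℕ
  s = ∣ + 2 * a - b ∣
  t = ∣ b ∣
  s≤2∣a∣+t : s ≤ 2 ℕ.* ∣ a ∣ ℕ.+ t
  s≤2∣a∣+t = subst₂ (λ p q → s ≤ p ℕ.+ q) (ℤ.abs-* (+ 2) a) (ℤ.∣-i∣≡∣i∣ b) (ℤ.∣i+j∣≤∣i∣+∣j∣ (+ 2 * a) (- b))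
  2s≤3n : 2 ℕ.* s ≤ 3 ℕ.* n
  2s≤3n = ℕ.≤-trans (ℕ.*-monoʳ-≤ 2 s≤2∣a∣+t)
            (subst₂ _≤_ (sym (ℕ.*-distribˡ-+ 2 (2 ℕ.* ∣ a ∣) t)) (2n+n≡3n n)
              (ℕ.+-mono-≤ (ℕ.*-monoʳ-≤ 2 2∣a∣≤n) 2∣b∣≤n))
  16N≤12n² : 16 ℕ.* Nω ⟨ a , b ⟩ ≤ 12 ℕ.* (n ℕ.* n)
  16N≤12n² = subst₂ _≤_
    (sym (trans (ℕ.*-assoc 4 4 (Nω ⟨ a , b ⟩)) (trans (cong (4 ℕ.*_) (4Nω≡ a b)) (doubling s t))))
    (nine-plus-three n)
    (ℕ.+-mono-≤ (ℕ.*-mono-≤ 2s≤3n 2s≤3n) (ℕ.*-monoʳ-≤ 3 (ℕ.*-mono-≤ 2∣b∣≤n 2∣b∣≤n)))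
  12n²<16n² : 12 ℕ.* (n ℕ.* n) < 16 ℕ.* (n ℕ.* n)
  12n²<16n² = ℕ.*-monoˡ-< (n ℕ.* n) {{ℕ.m*n≢0 n n}} (ℕ.m<m+n 12 {4} (s≤s z≤n))

ℤ[ω]-ring : ACR.AlmostCommutativeRing 0ℓ 0ℓ
ℤ[ω]-ring = ACR.fromCommutativeRing (record { isCommutativeRing = ℤ[ω]-isCommutativeRing })
  λ { ⟨ + 0 , + 0 ⟩ → just refl ; _ → nothing }

conj-norm : ∀ x → x *ω conj x ≡ ι (norm x)
conj-norm ⟨ a , b ⟩ = cong₂ ⟨_,_⟩ (re-part a b) (im-part a b)
  where
  re-part : ∀ a b → a * (a - b) - b * - b ≡ a * a - a * b + b * b
  re-part = solve-∀
  im-part : ∀ a b → a * - b + b * (a - b) - b * - b ≡ 0ℤ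
  im-part = solve-∀

Nω-conj : ∀ x → Nω (conj x) ≡ Nω x
Nω-conj ⟨ a , b ⟩ = cong ∣_∣ (norm-conj a b)
  where
  norm-conj : ∀ a b → (a - b) * (a - b) - (a - b) * - b + - b * - b ≡ a * a - a * b + b * b
  norm-conj = solve-∀

remainder-conj : ∀ α β q₁ q₂ r₁ r₂ → re (α *ω conj β) ≡ r₁ + q₁ * + Nω β → im (α *ω conj β) ≡ r₂ + q₂ * + Nω β →
                 (α +ω -ω (⟨ q₁ , q₂ ⟩ *ω β)) *ω conj β ≡ ⟨ r₁ , r₂ ⟩
remainder-conj α β q₁ q₂ r₁ r₂ reP≡ imP≡ = begin
  (α +ω -ω (q *ω β)) *ω conj β   ≡⟨ sub-*ʳ α q β (conj β) ⟩
  P +ω -ω (q *ω (β *ω conj β))   ≡⟨ cong (λ z → P +ω -ω (q *ω z)) (trans (conj-norm β) (cong ι (sym (+Nω≡norm β)))) ⟩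
  P +ω -ω (q *ω ι (+ n))         ≡⟨ cong₂ ⟨_,_⟩ (trans (cong (λ p → p + - (q₁ * + n - q₂ * 0ℤ)) reP≡) (cancel-re r₁ q₁ q₂ (+ n)))
                                               (trans (cong (λ p → p + - (q₁ * 0ℤ + q₂ * + n - q₂ * 0ℤ)) imP≡) (cancel-im r₂ q₁ q₂ (+ n))) ⟩
  ⟨ r₁ , r₂ ⟩                    ∎
  where
  n : ℕ
  n = Nω β
  q P : ℤ[ω]
  q = ⟨ q₁ , q₂ ⟩
  P = α *ω conj β
  sub-*ʳ : ∀ α q β γ → (α +ω -ω (q *ω β)) *ω γ ≡ α *ω γ +ω -ω (q *ω (β *ω γ))
  sub-*ʳ = RingSolver.solve-∀ ℤ[ω]-ring
  cancel-re : ∀ r q₁ q₂ m → r + q₁ * m + - (q₁ * m - q₂ * 0ℤ) ≡ r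
  cancel-re = solve-∀
  cancel-im : ∀ r q₁ q₂ m → r + q₂ * m + - (q₁ * 0ℤ + q₂ * m - q₂ * 0ℤ) ≡ r
  cancel-im = solve-∀

-- Rounding the coordinates of α β̄ / N(β) leaves a remainder of norm at most 3/4 · N(β).
ℤ[ω]-divMod : ∀ α β → β ≢ 0ω → ∃₂ λ q ρ → α ≡ ρ +ω q *ω β × Nω ρ < Nω β
ℤ[ω]-divMod α β β≢0 = divide (round (re (α *ω conj β)) n) (round (im (α *ω conj β)) n)
  where
  n : ℕ
  n = Nω β
  instance
    n≢0 : ℕ.NonZero n
    n≢0 = ℕ.≢-nonZero (β≢0 ∘ Nω≡0⇒≡0)
  add-back : ∀ α γ → α ≡ (α +ω -ω γ) +ω γ
  add-back = RingSolver.solve-∀ ℤ[ω]-ring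
  divide : (∃₂ λ q r → re (α *ω conj β) ≡ r + q * + n × 2 ℕ.* ∣ r ∣ ≤ n) →
           (∃₂ λ q r → im (α *ω conj β) ≡ r + q * + n × 2 ℕ.* ∣ r ∣ ≤ n) →
           ∃₂ λ q ρ → α ≡ ρ +ω q *ω β × Nω ρ < Nω β
  divide (q₁ , r₁ , reP≡ , r₁-small) (q₂ , r₂ , imP≡ , r₂-small) =
    ⟨ q₁ , q₂ ⟩ , ρ , add-back α (⟨ q₁ , q₂ ⟩ *ω β) ,
    ℕ.*-cancelʳ-< n (Nω ρ) n (subst (_< n ℕ.* n) Nρ*n≡ (Nω-small r₁ r₂ n r₁-small r₂-small))
    where
    ρ : ℤ[ω]
    ρ = α +ω -ω (⟨ q₁ , q₂ ⟩ *ω β)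
    Nρ*n≡ : Nω ⟨ r₁ , r₂ ⟩ ≡ Nω ρ ℕ.* n
    Nρ*n≡ = begin
      Nω ⟨ r₁ , r₂ ⟩           ≡⟨ cong Nω (sym (remainder-conj α β q₁ q₂ r₁ r₂ reP≡ imP≡)) ⟩
      Nω (ρ *ω conj β)         ≡⟨ Nω-* ρ (conj β) ⟩
      Nω ρ ℕ.* Nω (conj β)     ≡⟨ cong (Nω ρ ℕ.*_) (Nω-conj β) ⟩
      Nω ρ ℕ.* n               ∎

module Eisenstein = Coprimality ℤ[ω]-isCommutativeRing
module EisensteinEuclidean = Eisenstein.Euclidean Nω Nω-* refl Nω≡0⇒≡0 ℤ[ω]-divMod

unit-with-even-im : ∀ {u} → u Eisenstein.∣ 1ω → Even (im u) → u ≡ 1ω ⊎ u ≡ -ω 1ω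
unit-with-even-im {u@(⟨ a , b ⟩)} record { quotient = v ; equality = vu≡1 } (k , k2≡b) = by-∣k∣ ∣ k ∣ refl
  where
  Nu≡1 : Nω u ≡ 1
  Nu≡1 = ℕ.m*n≡1⇒n≡1 (Nω v) (Nω u) (trans (sym (Nω-* v u)) (cong Nω vu≡1))
  ∣b∣≡∣k∣*2 : ∣ b ∣ ≡ ∣ k ∣ ℕ.* 2
  ∣b∣≡∣k∣*2 = trans (cong ∣_∣ (sym k2≡b)) (ℤ.abs-* k (+ 2))
  by-∣k∣ : ∀ m → ∣ k ∣ ≡ m → u ≡ 1ω ⊎ u ≡ -ω 1ω
  by-∣k∣ zero ∣k∣≡0 = from-a (∣i∣≡1⇒i≡±1 ∣a∣≡1)
    where
    b≡0 : b ≡ 0ℤ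
    b≡0 = trans (sym k2≡b) (cong (_* + 2) (ℤ.∣i∣≡0⇒i≡0 {k} ∣k∣≡0))
    ∣a∣≡1 : ∣ a ∣ ≡ 1
    ∣a∣≡1 = ℕ.m*n≡1⇒n≡1 ∣ a ∣ ∣ a ∣ (trans (sym (Nω⟨a,0⟩ a)) (subst (λ b → Nω ⟨ a , b ⟩ ≡ 1) b≡0 Nu≡1))
    from-a : a ≡ 1ℤ ⊎ a ≡ - 1ℤ → u ≡ 1ω ⊎ u ≡ -ω 1ω
    from-a (inj₁ refl) = inj₁ (cong ⟨ 1ℤ ,_⟩ b≡0)
    from-a (inj₂ refl) = inj₂ (cong ⟨ - 1ℤ ,_⟩ b≡0)
  by-∣k∣ (suc m) ∣k∣≡1+m = ⊥-elim (12≰4 (ℕ.≤-trans (ℕ.*-monoʳ-≤ 3 (ℕ.*-mono-≤ 2≤∣b∣ 2≤∣b∣))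
    (ℕ.≤-trans (ℕ.m≤n+m (3 ℕ.* (∣ b ∣ ℕ.* ∣ b ∣)) (∣ + 2 * a - b ∣ ℕ.* ∣ + 2 * a - b ∣))
               (ℕ.≤-reflexive (trans (sym (4Nω≡ a b)) (cong (4 ℕ.*_) Nu≡1))))))
    where
    2≤∣b∣ : 2 ≤ ∣ b ∣
    2≤∣b∣ = subst (2 ≤_) (sym (trans ∣b∣≡∣k∣*2 (cong (ℕ._* 2) ∣k∣≡1+m))) (ℕ.m≤n*m 2 (suc m))
    12≰4 : ¬ 12 ≤ 4
    12≰4 (s≤s (s≤s (s≤s (s≤s ()))))

open Eisenstein using () renaming (_³ to _³ω)

cube-coords : ∀ c d → ⟨ c , d ⟩ ³ω ≡ ⟨ c * c * c - + 3 * c * d * d + d * d * d , + 3 * c * c * d - + 3 * c * d * d ⟩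
cube-coords c d = cong₂ ⟨_,_⟩ (re-part c d) (im-part c d)
  where
  re-part : ∀ c d → (c * c - d * d) * c - (c * d + d * c - d * d) * d ≡ c * c * c - + 3 * c * d * d + d * d * d
  re-part = solve-∀
  im-part : ∀ c d → (c * c - d * d) * d + (c * d + d * c - d * d) * c - (c * d + d * c - d * d) * d
                  ≡ + 3 * c * c * d - + 3 * c * d * d
  im-part = solve-∀

ω-mul : ∀ c d → ω *ω ⟨ c , d ⟩ ≡ ⟨ - d , c - d ⟩
ω-mul c d = cong₂ ⟨_,_⟩ (re-part c d) (im-part c d)
  where
  re-part : ∀ c d → 0ℤ * c - 1ℤ * d ≡ - d
  re-part = solve-∀
  im-part : ∀ c d → 0ℤ * d + 1ℤ * c - 1ℤ * d ≡ c - d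
  im-part = solve-∀

ω-cube : ∀ x → (ω *ω x) ³ω ≡ x ³ω
ω-cube x = trans (Eisenstein.*-³ ω x) (*-identityˡ-ω (x ³ω))
  where
  *-identityˡ-ω : ∀ y → 1ω *ω y ≡ y
  *-identityˡ-ω = RingSolver.solve-∀ ℤ[ω]-ring

-- Multiplying by ω leaves the cube unchanged (ω³ = 1) and permutes the three nonzero classes mod 2.
odd-cube-root : ∀ δ → (Even (re δ) × Even (im δ)) ⊎ ∃ λ η → η ³ω ≡ δ ³ω × Odd (re η) × Even (im η)
odd-cube-root δ@(⟨ c , d ⟩) with parity c | parity d
... | inj₁ 2∣c | inj₁ 2∣d = inj₁ (2∣c , 2∣d)
... | inj₂ (j , c≡1+2j) | inj₁ 2∣d = inj₂ (δ , refl , 1+2j-odd j c≡1+2j , 2∣d)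
... | inj₂ (j , refl) | inj₂ (k , refl) =
  inj₂ (⟨ - d , c - d ⟩ , trans (cong _³ω (sym (ω-mul c d))) (ω-cube δ) , 1+2j-odd (- k - 1ℤ) (odd-part k) , (j - k , even-part j k))
  where
  odd-part : ∀ k → - (1ℤ + k * + 2) ≡ 1ℤ + (- k - 1ℤ) * + 2
  odd-part = solve-∀
  even-part : ∀ j k → (j - k) * + 2 ≡ 1ℤ + j * + 2 - (1ℤ + k * + 2)
  even-part = solve-∀
... | inj₁ (i , refl) | inj₂ (k , refl) =
  inj₂ (⟨ - (c - d) , - d - (c - d) ⟩ , η³≡δ³ , 1+2j-odd (k - i) (odd-part i k) , (- i , even-part i k))
  where
  η³≡δ³ : ⟨ - (c - d) , - d - (c - d) ⟩ ³ω ≡ δ ³ω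
  η³≡δ³ = trans (cong _³ω (sym (ω-mul (- d) (c - d))))
            (trans (ω-cube ⟨ - d , c - d ⟩) (trans (cong _³ω (sym (ω-mul c d))) (ω-cube δ)))
  odd-part : ∀ i k → - (i * + 2 - (1ℤ + k * + 2)) ≡ 1ℤ + (k - i) * + 2
  odd-part = solve-∀
  even-part : ∀ i k → - i * + 2 ≡ - (1ℤ + k * + 2) - (i * + 2 - (1ℤ + k * + 2))
  even-part = solve-∀

odd-cube : ∀ {c d} → Odd c → Even d → Odd (re (⟨ c , d ⟩ ³ω)) × Even (im (⟨ c , d ⟩ ³ω))
odd-cube {c} {d} odd-c (k , refl) = subst (λ E → Odd (re E) × Even (im E)) (sym (cube-coords c (k * + 2)))
  (Coprime-+*ʳ {y = c * c * c} (+ 4 * k * k * k - + 6 * c * k * k) (re-part c k) (Coprime-³ʳ odd-c) ,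
   (+ 3 * c * c * k - + 6 * c * k * k , im-part c k))
  where
  re-part : ∀ c k → c * c * c - + 3 * c * (k * + 2) * (k * + 2) + k * + 2 * (k * + 2) * (k * + 2)
                  ≡ c * c * c + (+ 4 * k * k * k - + 6 * c * k * k) * + 2
  re-part = solve-∀
  im-part : ∀ c k → (+ 3 * c * c * k - + 6 * c * k * k) * + 2 ≡ + 3 * c * c * (k * + 2) - + 3 * c * (k * + 2) * (k * + 2)
  im-part = solve-∀

even-im-of-unit : ∀ u E → Odd (re E) → Even (im E) → Even (im (u *ω E)) → Even (im u)
even-im-of-unit ⟨ p , q ⟩ ⟨ P , Q ⟩ odd-P (k , refl) even-uE =
  coprime-divisor odd-P (subst Even (sym (rearrange p q P k)) (∣-+ even-uE (x∣ʳy⇒x∣ʳzy (q - p) (k , refl))))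
  where
  rearrange : ∀ p q P k → P * q ≡ p * (k * + 2) + q * P - q * (k * + 2) + (q - p) * (k * + 2)
  rearrange = solve-∀

even-base⇒even-re : ∀ u δ → Even (re δ) → Even (im δ) → Even (re (u *ω δ ³ω))
even-base⇒even-re ⟨ p , q ⟩ ⟨ c , d ⟩ (i , refl) (k , refl) =
  subst (λ E → Even (re (⟨ p , q ⟩ *ω E))) (sym (cube-coords (i * + 2) (k * + 2)))
    (p * (+ 4 * i * i * i - + 12 * i * k * k + + 4 * k * k * k) - q * (+ 12 * i * i * k - + 12 * i * k * k) , halve p q i k)
  where
  halve : ∀ p q i k → (p * (+ 4 * i * i * i - + 12 * i * k * k + + 4 * k * k * k) - q * (+ 12 * i * i * k - + 12 * i * k * k)) * + 2
        ≡ p * (i * + 2 * (i * + 2) * (i * + 2) - + 3 * (i * + 2) * (k * + 2) * (k * + 2) + k * + 2 * (k * + 2) * (k * + 2))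
          - q * (+ 3 * (i * + 2) * (i * + 2) * (k * + 2) - + 3 * (i * + 2) * (k * + 2) * (k * + 2))
  halve = solve-∀

-- A unit ±ω or ±ω² in front of the cube would make the imaginary part of α odd.
cube-normal-form : ∀ {α} → Eisenstein.UnitTimesCube α → Odd (re α) → Even (im α) → ∃ λ η → α ≡ η ³ω × Even (im η)
cube-normal-form {α} (u , δ , u∣1 , α≡uδ³) odd-re even-im with odd-cube-root δ
... | inj₁ (even-c , even-d) = ⊥-elim (Odd⇒¬Even odd-re (subst (Even ∘ re) (sym α≡uδ³) (even-base⇒even-re u δ even-c even-d)))
... | inj₂ (η@(⟨ c , d ⟩) , η³≡δ³ , odd-c , even-d) =
  by-unit (unit-with-even-im u∣1 (even-im-of-unit u (η ³ω) odd-E even-E (subst (Even ∘ im) α≡uη³ even-im)))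
  where
  α≡uη³ : α ≡ u *ω η ³ω
  α≡uη³ = trans α≡uδ³ (cong (u *ω_) (sym η³≡δ³))
  odd-E : Odd (re (η ³ω))
  odd-E = proj₁ (odd-cube odd-c even-d)
  even-E : Even (im (η ³ω))
  even-E = proj₂ (odd-cube odd-c even-d)
  by-unit : u ≡ 1ω ⊎ u ≡ -ω 1ω → ∃ λ η → α ≡ η ³ω × Even (im η)
  by-unit (inj₁ refl) = η , trans α≡uη³ (one-times (η ³ω)) , even-d
    where
    one-times : ∀ x → 1ω *ω x ≡ x
    one-times = RingSolver.solve-∀ ℤ[ω]-ring
  by-unit (inj₂ refl) = -ω η , trans α≡uη³ (minus-one-times η) , Even-neg even-d
    where
    minus-one-times : ∀ x → -ω 1ω *ω (x *ω x *ω x) ≡ (-ω x) *ω (-ω x) *ω (-ω x)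
    minus-one-times = RingSolver.solve-∀ ℤ[ω]-ring

ι-Coprime : ∀ {x y} → Coprime x y → Eisenstein.Coprime (ι x) (ι y)
ι-Coprime {x} {y} (l , m , lx+my≡1) = ι l , ι m , cong₂ ⟨_,_⟩ (trans (re-part l x m y) lx+my≡1) (im-part l x m y)
  where
  re-part : ∀ l x m y → l * x - 0ℤ * 0ℤ + (m * y - 0ℤ * 0ℤ) ≡ l * x + m * y
  re-part = solve-∀
  im-part : ∀ l x m y → l * 0ℤ + 0ℤ * x - 0ℤ * 0ℤ + (m * 0ℤ + 0ℤ * y - 0ℤ * 0ℤ) ≡ 0ℤ
  im-part = solve-∀

ι-³ : ∀ x → ι (x ³) ≡ ι x ³ω
ι-³ x = cong₂ ⟨_,_⟩ (re-part x) (im-part x)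
  where
  re-part : ∀ x → x * x * x ≡ (x * x - 0ℤ * 0ℤ) * x - (x * 0ℤ + 0ℤ * x - 0ℤ * 0ℤ) * 0ℤ
  re-part = solve-∀
  im-part : ∀ x → 0ℤ ≡ (x * x - 0ℤ * 0ℤ) * 0ℤ + (x * 0ℤ + 0ℤ * x - 0ℤ * 0ℤ) * x - (x * 0ℤ + 0ℤ * x - 0ℤ * 0ℤ) * 0ℤ
  im-part = solve-∀

-- ⟨ s + t , 2t ⟩ is s + t√−3, since √−3 = 1 + 2ω.
conjugate-product : ∀ s t → ⟨ s + t , + 2 * t ⟩ *ω ⟨ s - t , - (+ 2 * t) ⟩ ≡ ι (s * s + + 3 * (t * t))
conjugate-product s t = cong₂ ⟨_,_⟩ (re-part s t) (im-part s t)
  where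
  re-part : ∀ s t → (s + t) * (s - t) - + 2 * t * - (+ 2 * t) ≡ s * s + + 3 * (t * t)
  re-part = solve-∀
  im-part : ∀ s t → (s + t) * - (+ 2 * t) + + 2 * t * (s - t) - + 2 * t * - (+ 2 * t) ≡ 0ℤ
  im-part = solve-∀

conjugates-coprime : ∀ {s t} → Coprime s (+ 3 * t) → Odd (s + t) →
                     Eisenstein.Coprime ⟨ s + t , + 2 * t ⟩ ⟨ s - t , - (+ 2 * t) ⟩
conjugates-coprime {s} {t} (X , Y , Xs+Y3t≡1) odd =
  Eisenstein.Coprime-combination ⟨ X - Y , - (+ 2 * Y) ⟩ ⟨ X + Y , + 2 * Y ⟩
    (cong₂ ⟨_,_⟩ (trans (re-part X Y s t) (cong (+ 2 *_) Xs+Y3t≡1)) (im-part X Y s t))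
    (subst (Eisenstein.Coprime (ι (+ 2))) (sym (conjugate-product s t)) (ι-Coprime (x²+3y²-odd s t odd)))
  where
  re-part : ∀ X Y s t → (X - Y) * (s + t) - - (+ 2 * Y) * (+ 2 * t) + ((X + Y) * (s - t) - + 2 * Y * - (+ 2 * t))
                      ≡ + 2 * (X * s + Y * (+ 3 * t))
  re-part = solve-∀
  im-part : ∀ X Y s t → (X - Y) * (+ 2 * t) + - (+ 2 * Y) * (s + t) - - (+ 2 * Y) * (+ 2 * t)
                        + ((X + Y) * - (+ 2 * t) + + 2 * Y * (s - t) - + 2 * Y * - (+ 2 * t)) ≡ 0ℤ
  im-part = solve-∀

x²+3y²-cube : ∀ s t S → Coprime s (+ 3 * t) → Odd (s + t) → s * s + + 3 * (t * t) ≡ S ³ →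
              ∃₂ λ a b → s ≡ a * a * a - + 9 * a * b * b × t ≡ + 3 * a * a * b - + 3 * b * b * b
x²+3y²-cube s t S s⊥3t odd N≡S³ = from-normal-form (cube-normal-form α-unit-times-cube odd (t , ℤ.*-comm t (+ 2)))
  where
  α-unit-times-cube : Eisenstein.UnitTimesCube ⟨ s + t , + 2 * t ⟩
  α-unit-times-cube = EisensteinEuclidean.coprime-factor-of-cube {γ = ι S} (conjugates-coprime s⊥3t odd)
                      (trans (conjugate-product s t) (trans (cong ι N≡S³) (ι-³ S)))
  from-normal-form : (∃ λ η → ⟨ s + t , + 2 * t ⟩ ≡ η ³ω × Even (im η)) →
                     ∃₂ λ a b → s ≡ a * a * a - + 9 * a * b * b × t ≡ + 3 * a * a * b - + 3 * b * b * b
  from-normal-form (⟨ c , d ⟩ , α≡η³ , (b , refl)) = c - b , b , s≡ , t≡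
    where
    α≡ : ⟨ s + t , + 2 * t ⟩ ≡ ⟨ c * c * c - + 3 * c * (b * + 2) * (b * + 2) + b * + 2 * (b * + 2) * (b * + 2)
                               , + 3 * c * c * (b * + 2) - + 3 * c * (b * + 2) * (b * + 2) ⟩
    α≡ = trans α≡η³ (cube-coords c (b * + 2))
    t≡ : t ≡ + 3 * (c - b) * (c - b) * b - + 3 * b * b * b
    t≡ = ℤ.*-cancelˡ-≡ (+ 2) t (+ 3 * (c - b) * (c - b) * b - + 3 * b * b * b) (trans (cong im α≡) (im-part c b))
      where
      im-part : ∀ c b → + 3 * c * c * (b * + 2) - + 3 * c * (b * + 2) * (b * + 2)
                      ≡ + 2 * (+ 3 * (c - b) * (c - b) * b - + 3 * b * b * b)
      im-part = solve-∀
    s≡ : s ≡ (c - b) * (c - b) * (c - b) - + 9 * (c - b) * b * b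
    s≡ = trans (add-sub s t) (trans (cong₂ _-_ (cong re α≡) t≡) (re-part c b))
      where
      add-sub : ∀ s t → s ≡ (s + t) - t
      add-sub = solve-∀
      re-part : ∀ c b → c * c * c - + 3 * c * (b * + 2) * (b * + 2) + b * + 2 * (b * + 2) * (b * + 2)
                        - (+ 3 * (c - b) * (c - b) * b - + 3 * b * b * b)
                      ≡ (c - b) * (c - b) * (c - b) - + 9 * (c - b) * b * b
      re-part = solve-∀

_³ℕ : ℕ → ℕ
n ³ℕ = n ℕ.* n ℕ.* n

³ℕ-mono-≤ : ∀ {m n} → m ≤ n → m ³ℕ ≤ n ³ℕ
³ℕ-mono-≤ m≤n = ℕ.*-mono-≤ (ℕ.*-mono-≤ m≤n m≤n) m≤n

³ℕ-cancel-< : ∀ {m n} → m ³ℕ < n ³ℕ → m < n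
³ℕ-cancel-< {m} {n} m³<n³ = ℕ.≰⇒> (λ n≤m → ℕ.<⇒≱ m³<n³ (³ℕ-mono-≤ n≤m))

abs-³ : ∀ x → ∣ x ³ ∣ ≡ ∣ x ∣ ³ℕ
abs-³ x = trans (ℤ.abs-* (x * x) x) (cong (ℕ._* ∣ x ∣) (ℤ.abs-* x x))

PrimitiveSolution : ℤ → ℤ → ℤ → Set
PrimitiveSolution x y z = Coprime x y × x ³ + y ³ + z ³ ≡ 0ℤ × x * y * z ≢ 0ℤ

primitive-from-factors : ∀ {P Q R} → Coprime P Q → Coprime P R → Coprime Q R → P + Q + R ≡ 0ℤ →
  ∀ {c} → P * Q * R ≡ c ³ → c ≢ 0ℤ → ∃ λ p → ∃ λ q → ∃ λ r → PrimitiveSolution p q r × (p * q * r) ³ ≡ c ³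
primitive-from-factors {P} {Q} {R} P⊥Q P⊥R Q⊥R P+Q+R≡0 {c} PQR≡c³ c≢0 =
  from-cubes (pairwise-coprime-cubes {e = c} P⊥Q P⊥R Q⊥R PQR≡c³)
  where
  from-cubes : (∃ λ p → ∃ λ q → ∃ λ r → P ≡ p ³ × Q ≡ q ³ × R ≡ r ³) →
               ∃ λ p → ∃ λ q → ∃ λ r → PrimitiveSolution p q r × (p * q * r) ³ ≡ c ³
  from-cubes (p , q , r , P≡p³ , Q≡q³ , R≡r³) = p , q , r , (p⊥q , sum≡0 , pqr≢0) , pqr³≡c³
    where
    p⊥q : Coprime p q
    p⊥q = Coprime-sym (Coprime-∣ʳ (p * p , sym P≡p³) (Coprime-sym (Coprime-∣ʳ (q * q , sym Q≡q³) P⊥Q)))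
    sum≡0 : p ³ + q ³ + r ³ ≡ 0ℤ
    sum≡0 = trans (sym (cong₂ _+_ (cong₂ _+_ P≡p³ Q≡q³) R≡r³)) P+Q+R≡0
    pqr³≡c³ : (p * q * r) ³ ≡ c ³
    pqr³≡c³ = begin
      (p * q * r) ³     ≡⟨ trans (*-³ (p * q) r) (cong (_* r ³) (*-³ p q)) ⟩
      p ³ * q ³ * r ³   ≡⟨ sym (cong₂ _*_ (cong₂ _*_ P≡p³ Q≡q³) R≡r³) ⟩
      P * Q * R         ≡⟨ PQR≡c³ ⟩
      c ³               ∎
    pqr≢0 : p * q * r ≢ 0ℤ
    pqr≢0 pqr≡0 = ³-≢0 c≢0 (trans (sym pqr³≡c³) (cong _³ pqr≡0))

parametrization-coprime : ∀ s t a b → Coprime s t → s ≡ a * a * a - + 9 * a * b * b →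
                          t ≡ + 3 * a * a * b - + 3 * b * b * b → Coprime a b
parametrization-coprime s t a b s⊥t s≡ t≡ =
  Coprime-sym (Coprime-∣ʳ (a * a - + 9 * b * b , trans (s-factor a b) (sym s≡))
    (Coprime-sym (Coprime-∣ʳ (+ 3 * a * a - + 3 * b * b , trans (t-factor a b) (sym t≡)) s⊥t)))
  where
  s-factor : ∀ a b → (a * a - + 9 * b * b) * a ≡ a * a * a - + 9 * a * b * b
  s-factor = solve-∀
  t-factor : ∀ a b → (+ 3 * a * a - + 3 * b * b) * b ≡ + 3 * a * a * b - + 3 * b * b * b
  t-factor = solve-∀

parametrization-odd : ∀ s t a b → Odd (s + t) → s ≡ a * a * a - + 9 * a * b * b →
                      t ≡ + 3 * a * a * b - + 3 * b * b * b → Odd (a + b)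
parametrization-odd s t a b odd refl refl =
  Coprime-∣ʳ (a * a + b * b , ℤ.*-comm (a * a + b * b) (a + b))
    (Coprime-+*ʳ (+ 5 * a * b * b - a * a * b + + 2 * b * b * b) (mod-2-identity a b) odd)
  where
  mod-2-identity : ∀ a b → (a + b) * (a * a + b * b)
    ≡ a * a * a - + 9 * a * b * b + (+ 3 * a * a * b - + 3 * b * b * b) + (+ 5 * a * b * b - a * a * b + + 2 * b * b * b) * + 2
  mod-2-identity = solve-∀

no-cube-is-2 : ∀ n → n ³ℕ ≢ 2
no-cube-is-2 0 ()
no-cube-is-2 1 ()
no-cube-is-2 (suc (suc n)) n³≡2 = ℕ.<⇒≱ (s≤s (s≤s (s≤s z≤n))) (subst (8 ≤_) n³≡2 (³ℕ-mono-≤ {2} (s≤s (s≤s z≤n))))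

unit-abs : ∀ {u} → u ∣ 1ℤ → ∣ u ∣ ≡ 1
unit-abs u∣1 with ℤ-unit u∣1
... | inj₁ refl = refl
... | inj₂ refl = refl

x²+3y²≥2 : ∀ u v r → Coprime u v → + 2 * u ≡ r ³ → 2 ≤ ∣ u * u + + 3 * (v * v) ∣
x²+3y²≥2 u v r u⊥v 2u≡r³ = subst (2 ≤_) (cong ∣_∣ (sym (x²+3y²≡+ u v))) (by-v ∣ v ∣ refl)
  where
  by-v : ∀ n → ∣ v ∣ ≡ n → 2 ≤ ∣ u ∣ ℕ.* ∣ u ∣ ℕ.+ 3 ℕ.* (∣ v ∣ ℕ.* ∣ v ∣)
  by-v zero ∣v∣≡0 = ⊥-elim (no-cube-is-2 ∣ r ∣ (begin
    ∣ r ∣ ³ℕ       ≡⟨ sym (abs-³ r) ⟩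
    ∣ r ³ ∣        ≡⟨ cong ∣_∣ (sym 2u≡r³) ⟩
    ∣ + 2 * u ∣    ≡⟨ ℤ.abs-* (+ 2) u ⟩
    2 ℕ.* ∣ u ∣    ≡⟨ cong (2 ℕ.*_) (unit-abs (Coprime∧∣⇒unit u⊥v (subst (u ∣_) (sym (ℤ.∣i∣≡0⇒i≡0 ∣v∣≡0)) (u ∣0)))) ⟩
    2              ∎))
  by-v (suc k) ∣v∣≡1+k =
    ℕ.≤-trans (ℕ.≤-trans (ℕ.n≤1+n 2) (subst (λ n → 3 ≤ 3 ℕ.* (n ℕ.* n)) (sym ∣v∣≡1+k) (ℕ.m≤m*n 3 (suc k ℕ.* suc k))))
                           (ℕ.m≤n+m (3 ℕ.* (∣ v ∣ ℕ.* ∣ v ∣)) (∣ u ∣ ℕ.* ∣ u ∣))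

SmallerSolution : ℤ → Set
SmallerSolution w = ∃ λ p → ∃ λ q → ∃ λ r → PrimitiveSolution p q r × ∣ p * q * r ∣ < ∣ w ∣

smaller-solution : ∀ {P Q R} → Coprime P Q → Coprime P R → Coprime Q R → P + Q + R ≡ 0ℤ →
                   ∀ {c w} → P * Q * R ≡ c ³ → c ≢ 0ℤ → ∣ c ∣ ³ℕ < ∣ w ∣ ³ℕ → SmallerSolution w
smaller-solution P⊥Q P⊥R Q⊥R P+Q+R≡0 {c} {w} PQR≡c³ c≢0 c³<w³ =
  shrink (primitive-from-factors P⊥Q P⊥R Q⊥R P+Q+R≡0 {c} PQR≡c³ c≢0)
  where
  shrink : (∃ λ p → ∃ λ q → ∃ λ r → PrimitiveSolution p q r × (p * q * r) ³ ≡ c ³) → SmallerSolution w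
  shrink (p , q , r , is-primitive , pqr³≡c³) = p , q , r , is-primitive , ³ℕ-cancel-< (subst (_< ∣ w ∣ ³ℕ) ∣c∣³≡∣pqr∣³ c³<w³)
    where
    ∣c∣³≡∣pqr∣³ : ∣ c ∣ ³ℕ ≡ ∣ p * q * r ∣ ³ℕ
    ∣c∣³≡∣pqr∣³ = trans (sym (abs-³ c)) (trans (cong ∣_∣ (sym pqr³≡c³)) (abs-³ (p * q * r)))

factors-coprime-3∤a : ∀ a b → Coprime a b → Coprime (+ 3) a → Odd (a + b) →
  Coprime (a - + 3 * b) (a + + 3 * b) × Coprime (a - + 3 * b) (- (+ 2 * a)) × Coprime (a + + 3 * b) (- (+ 2 * a))
factors-coprime-3∤a a b a⊥b 3⊥a odd = P⊥Q , Coprime-neg (Coprime-*ʳ P⊥2 P⊥a) , Coprime-neg (Coprime-*ʳ Q⊥2 Q⊥a)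
  where
  P Q : ℤ
  P = a - + 3 * b
  Q = a + + 3 * b
  P-mod-2 : ∀ a b → a - + 3 * b ≡ a + b + (- b - b) * + 2
  P-mod-2 = solve-∀
  Q-mod-2 : ∀ a b → a + + 3 * b ≡ a + b + b * + 2
  Q-mod-2 = solve-∀
  P-mod-3 : ∀ a b → a - + 3 * b ≡ a + - b * + 3
  P-mod-3 = solve-∀
  P-mod-b : ∀ a b → a - + 3 * b ≡ a + - + 3 * b
  P-mod-b = solve-∀
  Q-mod-3 : ∀ a b → a + + 3 * b ≡ a + b * + 3
  Q-mod-3 = solve-∀
  a-mod-P : ∀ a b → a ≡ + 3 * b + 1ℤ * (a - + 3 * b)
  a-mod-P = solve-∀
  a-mod-Q : ∀ a b → a ≡ - (+ 3 * b) + 1ℤ * (a + + 3 * b)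
  a-mod-Q = solve-∀
  Q-mod-P : ∀ a b → a + + 3 * b ≡ + 2 * (+ 3 * b) + 1ℤ * (a - + 3 * b)
  Q-mod-P = solve-∀
  P⊥2 : Coprime P (+ 2)
  P⊥2 = Coprime-sym (Coprime-+*ʳ (- b - b) (P-mod-2 a b) odd)
  Q⊥2 : Coprime Q (+ 2)
  Q⊥2 = Coprime-sym (Coprime-+*ʳ b (Q-mod-2 a b) odd)
  P⊥3b : Coprime P (+ 3 * b)
  P⊥3b = Coprime-*ʳ (Coprime-sym (Coprime-+*ʳ (- b) (P-mod-3 a b) 3⊥a))
                    (Coprime-sym (Coprime-+*ʳ (- + 3) (P-mod-b a b) (Coprime-sym a⊥b)))
  Q⊥3b : Coprime Q (+ 3 * b)
  Q⊥3b = Coprime-*ʳ (Coprime-sym (Coprime-+*ʳ b (Q-mod-3 a b) 3⊥a))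
                    (Coprime-sym (Coprime-+*ʳ (+ 3) refl (Coprime-sym a⊥b)))
  P⊥a : Coprime P a
  P⊥a = Coprime-+*ʳ 1ℤ (a-mod-P a b) P⊥3b
  Q⊥a : Coprime Q a
  Q⊥a = Coprime-+*ʳ 1ℤ (a-mod-Q a b) (Coprime-neg Q⊥3b)
  P⊥Q : Coprime P Q
  P⊥Q = Coprime-+*ʳ 1ℤ (Q-mod-P a b) (Coprime-*ʳ P⊥2 P⊥3b)

factors-coprime-2b : ∀ a b → Coprime a b → Odd (a + b) →
  Coprime (a + b) (b - a) × Coprime (a + b) (- (+ 2 * b)) × Coprime (b - a) (- (+ 2 * b))
factors-coprime-2b a b a⊥b odd = P⊥Q , Coprime-neg P⊥2b , Coprime-neg (Coprime-*ʳ Q⊥2 Q⊥b)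
  where
  P Q : ℤ
  P = a + b
  Q = b - a
  P-mod-b : ∀ a b → a + b ≡ a + 1ℤ * b
  P-mod-b = solve-∀
  Q-mod-b : ∀ a b → b - a ≡ - a + 1ℤ * b
  Q-mod-b = solve-∀
  Q-mod-2 : ∀ a b → b - a ≡ a + b + - a * + 2
  Q-mod-2 = solve-∀
  Q-mod-P : ∀ a b → b - a ≡ + 2 * b + - 1ℤ * (a + b)
  Q-mod-P = solve-∀
  P⊥b : Coprime P b
  P⊥b = Coprime-sym (Coprime-+*ʳ 1ℤ (P-mod-b a b) (Coprime-sym a⊥b))
  Q⊥b : Coprime Q b
  Q⊥b = Coprime-sym (Coprime-+*ʳ 1ℤ (Q-mod-b a b) (Coprime-neg (Coprime-sym a⊥b)))
  Q⊥2 : Coprime Q (+ 2)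
  Q⊥2 = Coprime-sym (Coprime-+*ʳ (- a) (Q-mod-2 a b) odd)
  P⊥2b : Coprime P (+ 2 * b)
  P⊥2b = Coprime-*ʳ (Coprime-sym odd) P⊥b
  P⊥Q : Coprime P Q
  P⊥Q = Coprime-+*ʳ (- 1ℤ) (Q-mod-P a b) P⊥2b

∣w∣³≡∣r∣³∣K∣ : ∀ r K w → r ³ * K ≡ w ³ → ∣ w ∣ ³ℕ ≡ ∣ r ∣ ³ℕ ℕ.* ∣ K ∣
∣w∣³≡∣r∣³∣K∣ r K w r³K≡w³ = begin
  ∣ w ∣ ³ℕ             ≡⟨ sym (abs-³ w) ⟩
  ∣ w ³ ∣              ≡⟨ cong ∣_∣ (sym r³K≡w³) ⟩
  ∣ r ³ * K ∣          ≡⟨ ℤ.abs-* (r ³) K ⟩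
  ∣ r ³ ∣ ℕ.* ∣ K ∣    ≡⟨ cong (ℕ._* ∣ K ∣) (abs-³ r) ⟩
  ∣ r ∣ ³ℕ ℕ.* ∣ K ∣   ∎

nonzero-abs³ : ∀ {r} → r ≢ 0ℤ → ℕ.NonZero (∣ r ∣ ³ℕ)
nonzero-abs³ {r} r≢0 = ℕ.≢-nonZero (³-≢0 r≢0 ∘ ℤ.∣i∣≡0⇒i≡0 ∘ trans (abs-³ r))

Coprime-2u-norm : ∀ u v → Coprime (+ 3) u → Coprime u v → Odd (u + v) → Coprime (+ 2 * u) (u * u + + 3 * (v * v))
Coprime-2u-norm u v 3⊥u u⊥v odd = Coprime-sym (Coprime-*ʳ (Coprime-sym (x²+3y²-odd u v odd)) (Coprime-sym u⊥N))
  where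
  u⊥N : Coprime u (u * u + + 3 * (v * v))
  u⊥N = Coprime-+*ʳ u (ℤ.+-comm (u * u) (+ 3 * (v * v))) (Coprime-*ʳ (Coprime-sym 3⊥u) (Coprime-*ʳ u⊥v u⊥v))

Coprime-18s-norm : ∀ v s → Coprime v (+ 3) → Coprime v s → Odd (v + s) → Coprime (+ 18 * s) (v * v + + 3 * (s * s))
Coprime-18s-norm v s v⊥3 v⊥s odd = Coprime-sym (subst (Coprime M) (eighteen s)
  (Coprime-*ʳ (Coprime-sym (x²+3y²-odd v s odd)) (Coprime-*ʳ M⊥3 (Coprime-*ʳ M⊥3 M⊥s))))
  where
  M : ℤ
  M = v * v + + 3 * (s * s)
  eighteen : ∀ s → + 2 * (+ 3 * (+ 3 * s)) ≡ + 18 * s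
  eighteen = solve-∀
  M⊥3 : Coprime M (+ 3)
  M⊥3 = Coprime-sym (Coprime-+*ʳ (s * s) (cong (λ t → v * v + t) (ℤ.*-comm (+ 3) (s * s)))
          (Coprime-*ʳ (Coprime-sym v⊥3) (Coprime-sym v⊥3)))
  M⊥s : Coprime M s
  M⊥s = Coprime-sym (Coprime-+*ʳ (+ 3 * s) (cong (λ t → v * v + t) (sym (ℤ.*-assoc (+ 3) s s)))
          (Coprime-*ʳ (Coprime-sym v⊥s) (Coprime-sym v⊥s)))

descent-3∤u-parametrized : ∀ u v a b r w → Coprime (+ 3) u → Coprime u v → Odd (u + v) →
  u ≡ a * a * a - + 9 * a * b * b → v ≡ + 3 * a * a * b - + 3 * b * b * b →
  + 2 * u ≡ r ³ → r ≢ 0ℤ → ∣ r ∣ ³ℕ < ∣ w ∣ ³ℕ → SmallerSolution w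
descent-3∤u-parametrized u v a b r w 3⊥u u⊥v odd u≡ v≡ 2u≡r³ r≢0 r³<w³ =
  smaller-solution (proj₁ factors⊥) (proj₁ (proj₂ factors⊥)) (proj₂ (proj₂ factors⊥)) (sum-zero a b)
    {c = - r} {w} PQR≡-r³ (-‿≢0 r≢0) (subst (λ n → n ³ℕ < ∣ w ∣ ³ℕ) (sym (ℤ.∣-i∣≡∣i∣ r)) r³<w³)
  where
  sum-zero : ∀ a b → a - + 3 * b + (a + + 3 * b) + - (+ 2 * a) ≡ 0ℤ
  sum-zero = solve-∀
  3⊥a : Coprime (+ 3) a
  3⊥a = Coprime-∣ʳ (a * a - + 9 * b * b , trans (factor a b) (sym u≡)) 3⊥u
    where
    factor : ∀ a b → (a * a - + 9 * b * b) * a ≡ a * a * a - + 9 * a * b * b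
    factor = solve-∀
  factors⊥ : Coprime (a - + 3 * b) (a + + 3 * b) × Coprime (a - + 3 * b) (- (+ 2 * a)) × Coprime (a + + 3 * b) (- (+ 2 * a))
  factors⊥ = factors-coprime-3∤a a b (parametrization-coprime u v a b u⊥v u≡ v≡) 3⊥a (parametrization-odd u v a b odd u≡ v≡)
  PQR≡-r³ : (a - + 3 * b) * (a + + 3 * b) * - (+ 2 * a) ≡ (- r) ³
  PQR≡-r³ = begin
    (a - + 3 * b) * (a + + 3 * b) * - (+ 2 * a)  ≡⟨ product a b ⟩
    - (+ 2 * (a * a * a - + 9 * a * b * b))      ≡⟨ cong (λ t → - (+ 2 * t)) (sym u≡) ⟩
    - (+ 2 * u)                                  ≡⟨ cong -_ 2u≡r³ ⟩
    - (r ³)                                      ≡⟨ negate-cube r ⟩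
    (- r) ³                                      ∎
    where
    product : ∀ a b → (a - + 3 * b) * (a + + 3 * b) * - (+ 2 * a) ≡ - (+ 2 * (a * a * a - + 9 * a * b * b))
    product = solve-∀
    negate-cube : ∀ r → - (r * r * r) ≡ (- r) * (- r) * (- r)
    negate-cube = solve-∀

descent-3∤u : ∀ u v w → w ≢ 0ℤ → Coprime (+ 3) u → Coprime u v → Odd (u + v) →
              + 2 * u * (u * u + + 3 * (v * v)) ≡ w ³ → SmallerSolution w
descent-3∤u u v w w≢0 3⊥u u⊥v odd 2uN≡w³ =
  with-cubes (coprime-factor-of-cubeℤ {c = w} 2u⊥N 2uN≡w³)
             (coprime-factor-of-cubeℤ {c = w} (Coprime-sym 2u⊥N) (trans (ℤ.*-comm N (+ 2 * u)) 2uN≡w³))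
  where
  N : ℤ
  N = u * u + + 3 * (v * v)
  2u⊥N : Coprime (+ 2 * u) N
  2u⊥N = Coprime-2u-norm u v 3⊥u u⊥v odd
  with-cubes : (∃ λ r → + 2 * u ≡ r ³) → (∃ λ S → N ≡ S ³) → SmallerSolution w
  with-cubes (r , 2u≡r³) (S , N≡S³) = with-parametrization (x²+3y²-cube u v S (Coprime-*ʳ (Coprime-sym 3⊥u) u⊥v) odd N≡S³)
    where
    r³N≡w³ : r ³ * N ≡ w ³
    r³N≡w³ = trans (cong (_* N) (sym 2u≡r³)) 2uN≡w³
    r≢0 : r ≢ 0ℤ
    r≢0 r≡0 = ³-≢0 w≢0 (trans (sym r³N≡w³) (trans (cong (λ t → t ³ * N) r≡0) (ℤ.*-zeroˡ N)))
    r³<w³ : ∣ r ∣ ³ℕ < ∣ w ∣ ³ℕ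
    r³<w³ = subst (∣ r ∣ ³ℕ <_) (sym (∣w∣³≡∣r∣³∣K∣ r N w r³N≡w³))
              (ℕ.m<m*n (∣ r ∣ ³ℕ) ∣ N ∣ {{nonzero-abs³ r≢0}} (x²+3y²≥2 u v r u⊥v 2u≡r³))
    with-parametrization : (∃₂ λ a b → u ≡ a * a * a - + 9 * a * b * b × v ≡ + 3 * a * a * b - + 3 * b * b * b) →
                           SmallerSolution w
    with-parametrization (a , b , u≡ , v≡) = descent-3∤u-parametrized u v a b r w 3⊥u u⊥v odd u≡ v≡ 2u≡r³ r≢0 r³<w³

descent-3∣u-parametrized : ∀ v s a b r w → Coprime v s → Odd (v + s) →
  v ≡ a * a * a - + 9 * a * b * b → s ≡ + 3 * a * a * b - + 3 * b * b * b →
  + 18 * s ≡ r ³ → r ≢ 0ℤ → ∣ r ∣ ³ℕ ≤ ∣ w ∣ ³ℕ → SmallerSolution w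
descent-3∣u-parametrized v s a b r w v⊥s odd v≡ s≡ 18s≡r³ r≢0 r³≤w³ = with-third (³∣³⇒∣ {+ 3} {r} (PQR , 27PQR≡r³))
  where
  PQR : ℤ
  PQR = (a + b) * (b - a) * - (+ 2 * b)
  sum-zero : ∀ a b → a + b + (b - a) + - (+ 2 * b) ≡ 0ℤ
  sum-zero = solve-∀
  27PQR≡r³ : PQR * (+ 3) ³ ≡ r ³
  27PQR≡r³ = begin
    PQR * (+ 3) ³                               ≡⟨ product a b ⟩
    + 18 * (+ 3 * a * a * b - + 3 * b * b * b)  ≡⟨ cong (+ 18 *_) (sym s≡) ⟩
    + 18 * s                                    ≡⟨ 18s≡r³ ⟩
    r ³                                         ∎
    where
    product : ∀ a b → (a + b) * (b - a) * - (+ 2 * b) * (+ 3 * + 3 * + 3) ≡ + 18 * (+ 3 * a * a * b - + 3 * b * b * b)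
    product = solve-∀
  factors⊥ : Coprime (a + b) (b - a) × Coprime (a + b) (- (+ 2 * b)) × Coprime (b - a) (- (+ 2 * b))
  factors⊥ = factors-coprime-2b a b (parametrization-coprime v s a b v⊥s v≡ s≡) (parametrization-odd v s a b odd v≡ s≡)
  with-third : + 3 ∣ r → SmallerSolution w
  with-third (r′ , r′3≡r) = smaller-solution (proj₁ factors⊥) (proj₁ (proj₂ factors⊥)) (proj₂ (proj₂ factors⊥))
                              (sum-zero a b) {c = r′} {w} PQR≡r′³ r′≢0 (ℕ.<-≤-trans r′³<r³ r³≤w³)
    where
    r′≢0 : r′ ≢ 0ℤ
    r′≢0 r′≡0 = r≢0 (trans (sym r′3≡r) (cong (_* + 3) r′≡0))
    r³≡r′³27 : r ³ ≡ r′ ³ * (+ 3) ³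
    r³≡r′³27 = trans (cong _³ (sym r′3≡r)) (*-³ r′ (+ 3))
    PQR≡r′³ : PQR ≡ r′ ³
    PQR≡r′³ = ℤ.*-cancelʳ-≡ PQR (r′ ³) ((+ 3) ³) (trans 27PQR≡r³ r³≡r′³27)
    r′³<r³ : ∣ r′ ∣ ³ℕ < ∣ r ∣ ³ℕ
    r′³<r³ = subst (∣ r′ ∣ ³ℕ <_) (sym (∣w∣³≡∣r∣³∣K∣ r′ ((+ 3) ³) r (sym r³≡r′³27)))
               (ℕ.m<m*n (∣ r′ ∣ ³ℕ) 27 {{nonzero-abs³ r′≢0}} (s≤s (s≤s z≤n)))

-- With u = 3s the cube is 18s(v² + 3s²), and s = 3b(a − b)(a + b) makes 18s = 27 · 2b(a − b)(a + b).
descent-3∣u : ∀ u v w → w ≢ 0ℤ → + 3 ∣ u → Coprime u v → Odd (u + v) →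
              + 2 * u * (u * u + + 3 * (v * v)) ≡ w ³ → SmallerSolution w
descent-3∣u u v w w≢0 (s , s3≡u) u⊥v odd 2uN≡w³ =
  with-cubes (coprime-factor-of-cubeℤ {c = w} 18s⊥M 18sM≡w³)
             (coprime-factor-of-cubeℤ {c = w} (Coprime-sym 18s⊥M) (trans (ℤ.*-comm M (+ 18 * s)) 18sM≡w³))
  where
  M : ℤ
  M = v * v + + 3 * (s * s)
  18sM≡w³ : + 18 * s * M ≡ w ³
  18sM≡w³ = trans (sym (substitute s v)) (trans (cong (λ u → + 2 * u * (u * u + + 3 * (v * v))) s3≡u) 2uN≡w³)
    where
    substitute : ∀ s v → + 2 * (s * + 3) * (s * + 3 * (s * + 3) + + 3 * (v * v)) ≡ + 18 * s * (v * v + + 3 * (s * s))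
    substitute = solve-∀
  v⊥s : Coprime v s
  v⊥s = Coprime-∣ʳ (+ 3 , trans (ℤ.*-comm (+ 3) s) s3≡u) (Coprime-sym u⊥v)
  odd′ : Odd (v + s)
  odd′ = Coprime-+*ʳ (- s) (trans (shift s v) (cong (λ u → u + v + - s * + 2) s3≡u)) odd
    where
    shift : ∀ s v → v + s ≡ s * + 3 + v + - s * + 2
    shift = solve-∀
  18s⊥M : Coprime (+ 18 * s) M
  18s⊥M = Coprime-18s-norm v s (Coprime-∣ʳ (s , s3≡u) (Coprime-sym u⊥v)) v⊥s odd′
  with-cubes : (∃ λ r → + 18 * s ≡ r ³) → (∃ λ S → M ≡ S ³) → SmallerSolution w
  with-cubes (r , 18s≡r³) (S , M≡S³) = with-parametrization (x²+3y²-cube v s S (Coprime-*ʳ v⊥3 v⊥s) odd′ M≡S³)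
    where
    v⊥3 : Coprime v (+ 3)
    v⊥3 = Coprime-∣ʳ (s , s3≡u) (Coprime-sym u⊥v)
    r³M≡w³ : r ³ * M ≡ w ³
    r³M≡w³ = trans (cong (_* M) (sym 18s≡r³)) 18sM≡w³
    r≢0 : r ≢ 0ℤ
    r≢0 r≡0 = ³-≢0 w≢0 (trans (sym r³M≡w³) (trans (cong (λ t → t ³ * M) r≡0) (ℤ.*-zeroˡ M)))
    r³≤w³ : ∣ r ∣ ³ℕ ≤ ∣ w ∣ ³ℕ
    r³≤w³ = subst (∣ r ∣ ³ℕ ≤_) (sym (∣w∣³≡∣r∣³∣K∣ r M w r³M≡w³))
              (ℕ.m≤m*n (∣ r ∣ ³ℕ) ∣ M ∣ {{ℕ.≢-nonZero (Odd⇒≢0 (x²+3y²-odd v s odd′) ∘ ℤ.∣i∣≡0⇒i≡0)}})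
    with-parametrization : (∃₂ λ a b → v ≡ a * a * a - + 9 * a * b * b × s ≡ + 3 * a * a * b - + 3 * b * b * b) →
                           SmallerSolution w
    with-parametrization (a , b , v≡ , s≡) = descent-3∣u-parametrized v s a b r w v⊥s odd′ v≡ s≡ 18s≡r³ r≢0 r³≤w³

descent : ∀ u v w → w ≢ 0ℤ → Coprime u v → Odd (u + v) →
          + 2 * u * (u * u + + 3 * (v * v)) ≡ w ³ → SmallerSolution w
descent u v w w≢0 u⊥v odd 2uN≡w³ with 3∣⊎Coprime3 u
... | inj₁ 3∣u = descent-3∣u u v w w≢0 3∣u u⊥v odd 2uN≡w³
... | inj₂ 3⊥u = descent-3∤u u v w w≢0 3⊥u u⊥v odd 2uN≡w³

SmallerSolution-mono : ∀ w w′ → ∣ w ∣ ≤ ∣ w′ ∣ → SmallerSolution w → SmallerSolution w′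
SmallerSolution-mono w w′ w≤w′ (p , q , r , is-primitive , smaller) = p , q , r , is-primitive , ℕ.<-≤-trans smaller w≤w′

Coprime-third : ∀ x y z → Coprime x y → x ³ + y ³ + z ³ ≡ 0ℤ → Coprime x z
Coprime-third x y z x⊥y sum≡0 =
  Coprime-∣ʳ (z * z , refl) (Coprime-+*ʳ (- (x * x)) z³≡ (Coprime-neg (Coprime-³ʳ x⊥y)))
  where
  z³≡ : z ³ ≡ - (y ³) + - (x * x) * x
  z³≡ = begin
    z * z * z                                                    ≡⟨ rearrange x y z ⟩
    x * x * x + y * y * y + z * z * z + (- (y * y * y) + - (x * x) * x) ≡⟨ cong (_+ (- (y * y * y) + - (x * x) * x)) sum≡0 ⟩
    0ℤ + (- (y * y * y) + - (x * x) * x)                         ≡⟨ ℤ.+-identityˡ _ ⟩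
    - (y * y * y) + - (x * x) * x                                ∎
    where
    rearrange : ∀ x y z → z * z * z ≡ x * x * x + y * y * y + z * z * z + (- (y * y * y) + - (x * x) * x)
    rearrange = solve-∀

Even⇒Odd-partner : ∀ {x y} → Even x → Coprime x y → Odd y
Even⇒Odd-partner even-x x⊥y = Coprime-sym (Coprime-∣ʳ even-x (Coprime-sym x⊥y))

Coprime-sum-diff : ∀ u v → Coprime (u + v) (u - v) → Coprime u v
Coprime-sum-diff u v (l , m , e) = l + m , l - m , trans (regroup l m u v) e
  where
  regroup : ∀ l m u v → (l + m) * u + (l - m) * v ≡ l * (u + v) + m * (u - v)
  regroup = solve-∀

half-sum-difference : ∀ {x y} → Odd x → Odd y → ∃₂ λ u v → x ≡ u + v × y ≡ u - v
half-sum-difference odd-x odd-y with Odd⇒1+2j odd-x | Odd⇒1+2j odd-y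
... | j , x≡1+2j | k , y≡1+2k = 1ℤ + j + k , j - k , trans x≡1+2j (sum j k) , trans y≡1+2k (difference j k)
  where
  sum : ∀ j k → 1ℤ + j * + 2 ≡ 1ℤ + j + k + (j - k)
  sum = solve-∀
  difference : ∀ j k → 1ℤ + k * + 2 ≡ 1ℤ + j + k - (j - k)
  difference = solve-∀

sum-of-two-cubes : ∀ u v z → (u + v) ³ + (u - v) ³ + z ³ ≡ 0ℤ → + 2 * u * (u * u + + 3 * (v * v)) ≡ (- z) ³
sum-of-two-cubes u v z sum≡0 = begin
  + 2 * u * (u * u + + 3 * (v * v))                            ≡⟨ expand u v z ⟩
  (u + v) ³ + (u - v) ³ + z ³ + - (z ³)                        ≡⟨ cong (_+ - (z ³)) sum≡0 ⟩
  0ℤ + - (z ³)                                                 ≡⟨ ℤ.+-identityˡ (- (z ³)) ⟩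
  - (z ³)                                                      ≡⟨ negate-cube z ⟩
  (- z) ³                                                      ∎
  where
  expand : ∀ u v z → + 2 * u * (u * u + + 3 * (v * v))
                   ≡ (u + v) * (u + v) * (u + v) + (u - v) * (u - v) * (u - v) + z * z * z + - (z * z * z)
  expand = solve-∀
  negate-cube : ∀ z → - (z * z * z) ≡ (- z) * (- z) * (- z)
  negate-cube = solve-∀

descent-odd-pair : ∀ x y z → PrimitiveSolution x y z → Odd x → Odd y → SmallerSolution (x * y * z)
descent-odd-pair x y z (x⊥y , sum≡0 , xyz≢0) odd-x odd-y = from-halves (half-sum-difference odd-x odd-y)
  where
  z≢0 : z ≢ 0ℤ
  z≢0 z≡0 = xyz≢0 (trans (cong (x * y *_) z≡0) (ℤ.*-zeroʳ (x * y)))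
  ∣z∣≤∣xyz∣ : ∣ - z ∣ ≤ ∣ x * y * z ∣
  ∣z∣≤∣xyz∣ = subst₂ _≤_ (sym (ℤ.∣-i∣≡∣i∣ z)) (sym (ℤ.abs-* (x * y) z))
                (ℕ.m≤n*m ∣ z ∣ ∣ x * y ∣ {{ℕ.≢-nonZero xy≢0}})
    where
    xy≢0 : ∣ x * y ∣ ≢ 0
    xy≢0 ∣xy∣≡0 = xyz≢0 (trans (cong (_* z) (ℤ.∣i∣≡0⇒i≡0 {x * y} ∣xy∣≡0)) (ℤ.*-zeroˡ z))
  from-halves : (∃₂ λ u v → x ≡ u + v × y ≡ u - v) → SmallerSolution (x * y * z)
  from-halves (u , v , x≡u+v , y≡u-v) = SmallerSolution-mono (- z) (x * y * z) ∣z∣≤∣xyz∣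
    (descent u v (- z) (-‿≢0 z≢0) (Coprime-sum-diff u v (subst₂ Coprime x≡u+v y≡u-v x⊥y)) (subst Odd x≡u+v odd-x)
      (sum-of-two-cubes u v z (subst₂ (λ s t → s ³ + t ³ + z ³ ≡ 0ℤ) x≡u+v y≡u-v sum≡0)))

swap₂₃ : ∀ x y z → PrimitiveSolution x y z → PrimitiveSolution x z y
swap₂₃ x y z (x⊥y , sum≡0 , xyz≢0) =
  Coprime-third x y z x⊥y sum≡0 , trans (swap-sum x y z) sum≡0 , xyz≢0 ∘ trans (swap-product x y z)
  where
  swap-sum : ∀ x y z → x * x * x + z * z * z + y * y * y ≡ x * x * x + y * y * y + z * z * z
  swap-sum = solve-∀
  swap-product : ∀ x y z → x * y * z ≡ x * z * y
  swap-product = solve-∀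

rotate : ∀ x y z → PrimitiveSolution x y z → PrimitiveSolution y z x
rotate x y z (x⊥y , sum≡0 , xyz≢0) =
  Coprime-third y x z (Coprime-sym x⊥y) (trans (swap-sum x y z) sum≡0) , trans (rotate-sum x y z) sum≡0 ,
  xyz≢0 ∘ trans (rotate-product x y z)
  where
  swap-sum : ∀ x y z → y * y * y + x * x * x + z * z * z ≡ x * x * x + y * y * y + z * z * z
  swap-sum = solve-∀
  rotate-sum : ∀ x y z → y * y * y + z * z * z + x * x * x ≡ x * x * x + y * y * y + z * z * z
  rotate-sum = solve-∀
  rotate-product : ∀ x y z → x * y * z ≡ y * z * x
  rotate-product = solve-∀

descent-step : ∀ x y z → PrimitiveSolution x y z → SmallerSolution (x * y * z)
descent-step x y z xyz@(x⊥y , sum≡0 , _) with Even⊎Odd x | Even⊎Odd y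
... | inj₂ odd-x | inj₂ odd-y = descent-odd-pair x y z xyz odd-x odd-y
... | inj₂ odd-x | inj₁ even-y = SmallerSolution-mono (x * z * y) (x * y * z) (ℕ.≤-reflexive (cong ∣_∣ (swap-product x y z)))
  (descent-odd-pair x z y (swap₂₃ x y z xyz) odd-x (Even⇒Odd-partner even-y (proj₁ (rotate x y z xyz))))
  where
  swap-product : ∀ x y z → x * z * y ≡ x * y * z
  swap-product = solve-∀
... | inj₁ even-x | _ = SmallerSolution-mono (y * z * x) (x * y * z) (ℕ.≤-reflexive (cong ∣_∣ (rotate-product x y z)))
  (descent-odd-pair y z x (rotate x y z xyz) (Even⇒Odd-partner even-x x⊥y) (Even⇒Odd-partner even-x (proj₁ (swap₂₃ x y z xyz))))
  where
  rotate-product : ∀ x y z → y * z * x ≡ x * y * z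
  rotate-product = solve-∀

no-primitive-solution : ∀ x y z → ¬ PrimitiveSolution x y z
no-primitive-solution x y z = go x y z (<-wellFounded ∣ x * y * z ∣)
  where
  go : ∀ x y z → Acc _<_ ∣ x * y * z ∣ → ¬ PrimitiveSolution x y z
  go x y z (acc rec) xyz = recurse (descent-step x y z xyz)
    where
    recurse : SmallerSolution (x * y * z) → ⊥
    recurse (p , q , r , pqr , smaller) = go p q r (rec smaller) pqr

fermat-cubes : ∀ x y z → Coprime x y → x ³ + y ³ + z ³ ≡ 0ℤ → x * y * z ≡ 0ℤ
fermat-cubes x y z x⊥y sum≡0 with x * y * z ℤ.≟ 0ℤ
... | yes xyz≡0 = xyz≡0
... | no xyz≢0 = ⊥-elim (no-primitive-solution x y z (x⊥y , sum≡0 , xyz≢0))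

coprime-zero-sum-cube : ∀ a b e → Coprime a b → a * b * - (a + b) ≡ e ³ → a * b * - (a + b) ≡ 0ℤ
coprime-zero-sum-cube a b e a⊥b abc≡e³ = from-cubes (pairwise-coprime-cubes {e = e} a⊥b a⊥c b⊥c abc≡e³)
  where
  a⊥c : Coprime a (- (a + b))
  a⊥c = Coprime-neg (Coprime-+*ʳ 1ℤ (shift a b) a⊥b)
    where
    shift : ∀ a b → a + b ≡ b + 1ℤ * a
    shift = solve-∀
  b⊥c : Coprime b (- (a + b))
  b⊥c = Coprime-neg (Coprime-+*ʳ 1ℤ (shift a b) (Coprime-sym a⊥b))
    where
    shift : ∀ a b → a + b ≡ a + 1ℤ * b
    shift = solve-∀
  from-cubes : (∃ λ x → ∃ λ y → ∃ λ z → a ≡ x ³ × b ≡ y ³ × - (a + b) ≡ z ³) → a * b * - (a + b) ≡ 0ℤ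
  from-cubes (x , y , z , a≡x³ , b≡y³ , c≡z³) = begin
    a * b * - (a + b)    ≡⟨ cong₂ _*_ (cong₂ _*_ a≡x³ b≡y³) c≡z³ ⟩
    x ³ * y ³ * z ³      ≡⟨ sym (trans (*-³ (x * y) z) (cong (_* z ³) (*-³ x y))) ⟩
    (x * y * z) ³        ≡⟨ cong _³ (fermat-cubes x y z x⊥y sum≡0) ⟩
    0ℤ                   ∎
    where
    x⊥y : Coprime x y
    x⊥y = Coprime-sym (Coprime-∣ʳ (x * x , sym a≡x³) (Coprime-sym (Coprime-∣ʳ (y * y , sym b≡y³) a⊥b)))
    sum≡0 : x ³ + y ³ + z ³ ≡ 0ℤ
    sum≡0 = trans (sym (cong₂ _+_ (cong₂ _+_ a≡x³ b≡y³) c≡z³)) (cancel a b)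
      where
      cancel : ∀ a b → a + b + - (a + b) ≡ 0ℤ
      cancel = solve-∀

zero-sum-product : ∀ {A B C} a b d → a * d ≡ A → b * d ≡ B → A + B + C ≡ 0ℤ → A * B * C ≡ a * b * - (a + b) * d ³
zero-sum-product {A} {B} {C} a b d refl refl A+B+C≡0 = begin
  a * d * (b * d) * C                    ≡⟨ cong (a * d * (b * d) *_) (isolate (a * d + b * d) C A+B+C≡0) ⟩
  a * d * (b * d) * - (a * d + b * d)    ≡⟨ regroup a b d ⟩
  a * b * - (a + b) * d ³                ∎
  where
  isolate : ∀ S C → S + C ≡ 0ℤ → C ≡ - S
  isolate S C S+C≡0 = trans (add-zero S C) (trans (cong (_+ - S) S+C≡0) (ℤ.+-identityˡ (- S)))
    where
    add-zero : ∀ S C → C ≡ S + C + - S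
    add-zero = solve-∀
  regroup : ∀ a b d → a * d * (b * d) * - (a * d + b * d) ≡ a * b * - (a + b) * (d * d * d)
  regroup = solve-∀

cube-product-of-zero-sum : ∀ A B C E → A + B + C ≡ 0ℤ → A * B * C ≡ E ³ → A * B * C ≡ 0ℤ
cube-product-of-zero-sum A B C E sum≡0 ABC≡E³ = from-gcd (gcd A B)
  where
  from-gcd : Gcd A B → A * B * C ≡ 0ℤ
  from-gcd record { gcd = d ; gcd∣x = a , ad≡A ; gcd∣y = b , bd≡B ; l = l ; m = m ; bézout = d≡lA+mB } with d ≟0
  ... | yes refl = trans (cong (λ t → t * B * C) (sym ad≡A)) (annihilate a B C)
    where
    annihilate : ∀ a B C → a * 0ℤ * B * C ≡ 0ℤ
    annihilate = solve-∀
  ... | no d≢0 = from-root (³∣³⇒∣ {d} {E} (a * b * - (a + b) , trans (sym ABC≡) ABC≡E³))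
    where
    ABC≡ : A * B * C ≡ a * b * - (a + b) * d ³
    ABC≡ = zero-sum-product a b d ad≡A bd≡B sum≡0
    a⊥b : Coprime a b
    a⊥b = Coprime-cofactors l m d≢0 (trans d≡lA+mB (cong₂ (λ s t → l * s + m * t) (sym ad≡A) (sym bd≡B)))
    from-root : d ∣ E → A * B * C ≡ 0ℤ
    from-root (e , ed≡E) = begin
      A * B * C                  ≡⟨ ABC≡ ⟩
      a * b * - (a + b) * d ³    ≡⟨ cong (_* d ³) (coprime-zero-sum-cube a b e a⊥b abc≡e³) ⟩
      0ℤ * d ³                   ≡⟨ ℤ.*-zeroˡ (d ³) ⟩
      0ℤ                         ∎
      where
      abc≡e³ : a * b * - (a + b) ≡ e ³
      abc≡e³ = *-cancelˡ (³-≢0 d≢0) (begin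
        d ³ * (a * b * - (a + b))   ≡⟨ ℤ.*-comm (d ³) (a * b * - (a + b)) ⟩
        a * b * - (a + b) * d ³     ≡⟨ sym ABC≡ ⟩
        A * B * C                   ≡⟨ ABC≡E³ ⟩
        E ³                         ≡⟨ cong _³ (sym ed≡E) ⟩
        (e * d) ³                   ≡⟨ trans (*-³ e d) (ℤ.*-comm (e ³) (d ³)) ⟩
        d ³ * e ³                   ∎)

n<2^n : ∀ n → n < 2 ^ n
n<2^n zero = s≤s z≤n
n<2^n (suc n) = ℕ.<-≤-trans (s≤s (n<2^n n))
  (subst (suc (2 ^ n) ≤_) (cong (2 ^ n ℕ.+_) (sym (ℕ.+-identityʳ (2 ^ n)))) (ℕ.+-monoˡ-≤ (2 ^ n) (ℕ.m^n>0 2 n)))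

-- If n ≡ r (mod 3) with r ∈ {1, 2} then m = 3N + r gives mn ≡ r² ≡ 1 (mod 3).
exponents : ∀ n N → n % 3 ≢ 0 → ∃₂ λ k m → suc (k ℕ.* 3) ≡ m ℕ.* n × N < m
exponents n N n%3≢0 with n % 3 | m≡m%n+[m/n]*n n 3 | m%n<n n 3
... | 0 | _ | _ = ⊥-elim (n%3≢0 refl)
... | 1 | n≡1+q*3 | _ = k , 1 ℕ.+ N ℕ.* 3 , trans (product (n / 3) N) (cong ((1 ℕ.+ N ℕ.* 3) ℕ.*_) (sym n≡1+q*3)) ,
                         s≤s (ℕ.m≤m*n N 3)
  where
  k : ℕ
  k = n / 3 ℕ.+ N ℕ.+ N ℕ.* 3 ℕ.* (n / 3)
  product : ∀ q N → suc ((q ℕ.+ N ℕ.+ N ℕ.* 3 ℕ.* q) ℕ.* 3) ≡ (1 ℕ.+ N ℕ.* 3) ℕ.* (1 ℕ.+ q ℕ.* 3)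
  product = ℕ-solve.solve-∀
... | 2 | n≡2+q*3 | _ = k , 2 ℕ.+ N ℕ.* 3 , trans (product (n / 3) N) (cong ((2 ℕ.+ N ℕ.* 3) ℕ.*_) (sym n≡2+q*3)) ,
                         s≤s (ℕ.≤-trans (ℕ.m≤m*n N 3) (ℕ.n≤1+n (N ℕ.* 3)))
  where
  k : ℕ
  k = 1 ℕ.+ 2 ℕ.* (n / 3) ℕ.+ 2 ℕ.* N ℕ.+ N ℕ.* 3 ℕ.* (n / 3)
  product : ∀ q N → suc ((1 ℕ.+ 2 ℕ.* q ℕ.+ 2 ℕ.* N ℕ.+ N ℕ.* 3 ℕ.* q) ℕ.* 3) ≡ (2 ℕ.+ N ℕ.* 3) ℕ.* (2 ℕ.+ q ℕ.* 3)
  product = ℕ-solve.solve-∀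
... | suc (suc (suc _)) | _ | s≤s (s≤s (s≤s ()))

powers-of-two-solution : ∀ n k m → suc (k ℕ.* 3) ≡ m ℕ.* n →
                         IsSolution n (2 ^ k) (2 ^ k) (2 ^ k ℕ.+ 2 ^ k) (2 ^ m)
powers-of-two-solution n k m 3k+1≡mn =
  ℕ.m^n>0 2 k , ℕ.m^n>0 2 k , ℕ.<-≤-trans (ℕ.m^n>0 2 k) (ℕ.m≤m+n (2 ^ k) (2 ^ k)) , ℕ.m^n>0 2 m , refl , (begin
    2 ^ k ℕ.* 2 ^ k ℕ.* (2 ^ k ℕ.+ 2 ^ k)   ≡⟨ double-cube (2 ^ k) ⟩
    2 ℕ.* (2 ^ k) ^ 3                       ≡⟨ cong (2 ℕ.*_) (ℕ.^-*-assoc 2 k 3) ⟩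
    2 ^ suc (k ℕ.* 3)                       ≡⟨ cong (2 ^_) 3k+1≡mn ⟩
    2 ^ (m ℕ.* n)                           ≡⟨ sym (ℕ.^-*-assoc 2 m n) ⟩
    (2 ^ m) ^ n                             ∎)
  where
  double-cube : ∀ P → P ℕ.* P ℕ.* (P ℕ.+ P) ≡ 2 ℕ.* (P ℕ.* (P ℕ.* (P ℕ.* 1)))
  double-cube = ℕ-solve.solve-∀

infinitely-many-solutions : ∀ n → n % 3 ≢ 0 → InfinitelyManySolutions n
infinitely-many-solutions n n%3≢0 N with exponents n N n%3≢0
... | k , m , 3k+1≡mn , N<m = 2 ^ k , 2 ^ k , 2 ^ k ℕ.+ 2 ^ k , 2 ^ m ,
  ℕ.<-≤-trans (ℕ.<-trans N<m (n<2^n m)) (ℕ.m≤n+m (2 ^ m) (2 ^ k ℕ.+ 2 ^ k ℕ.+ (2 ^ k ℕ.+ 2 ^ k))) ,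
  powers-of-two-solution n k m 3k+1≡mn

cube-product-of-sum : ∀ A B C E → A ℕ.+ B ≡ C → A ℕ.* B ℕ.* C ≡ E ℕ.* E ℕ.* E → A ℕ.* B ℕ.* C ≡ 0
cube-product-of-sum A B C E A+B≡C ABC≡E³ = begin
  A ℕ.* B ℕ.* C                ≡⟨ cong (A ℕ.* B ℕ.*_) (sym (ℤ.∣-i∣≡∣i∣ (+ C))) ⟩
  A ℕ.* B ℕ.* ∣ - + C ∣        ≡⟨ sym (trans (ℤ.abs-* (+ A * + B) (- + C)) (cong (ℕ._* ∣ - + C ∣) (ℤ.abs-* (+ A) (+ B)))) ⟩
  ∣ + A * + B * - + C ∣        ≡⟨ cong ∣_∣ (cube-product-of-zero-sum (+ A) (+ B) (- + C) (- + E) sum≡0 product≡) ⟩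
  0                            ∎
  where
  pos-*³ : ∀ a b c → + (a ℕ.* b ℕ.* c) ≡ + a * + b * + c
  pos-*³ a b c = trans (ℤ.pos-* (a ℕ.* b) c) (cong (_* + c) (ℤ.pos-* a b))
  sum≡0 : + A + + B + - + C ≡ 0ℤ
  sum≡0 = trans (cong (_+ - + C) (trans (sym (ℤ.pos-+ A B)) (cong +_ A+B≡C))) (ℤ.+-inverseʳ (+ C))
  product≡ : + A * + B * - + C ≡ (- + E) ³
  product≡ = begin
    + A * + B * - + C        ≡⟨ negate-last (+ A) (+ B) (+ C) ⟩
    - (+ A * + B * + C)      ≡⟨ cong -_ (trans (sym (pos-*³ A B C)) (trans (cong +_ ABC≡E³) (pos-*³ E E E))) ⟩
    - (+ E * + E * + E)      ≡⟨ negate-cube (+ E) ⟩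
    (- + E) ³                ∎
    where
    negate-last : ∀ a b c → a * b * - c ≡ - (a * b * c)
    negate-last = solve-∀
    negate-cube : ∀ e → - (e * e * e) ≡ (- e) * (- e) * (- e)
    negate-cube = solve-∀

power-of-multiple-of-3 : ∀ D n → n % 3 ≡ 0 → D ^ n ≡ D ^ (n / 3) ℕ.* D ^ (n / 3) ℕ.* D ^ (n / 3)
power-of-multiple-of-3 D n n%3≡0 = begin
  D ^ n                  ≡⟨ cong (D ^_) (trans (m≡m%n+[m/n]*n n 3) (cong (ℕ._+ n / 3 ℕ.* 3) n%3≡0)) ⟩
  D ^ (n / 3 ℕ.* 3)      ≡⟨ sym (ℕ.^-*-assoc D (n / 3) 3) ⟩
  (D ^ (n / 3)) ^ 3      ≡⟨ cube (D ^ (n / 3)) ⟩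
  D ^ (n / 3) ℕ.* D ^ (n / 3) ℕ.* D ^ (n / 3) ∎
  where
  cube : ∀ E → E ℕ.* (E ℕ.* (E ℕ.* 1)) ≡ E ℕ.* E ℕ.* E
  cube = ℕ-solve.solve-∀

no-solutions : ∀ n → n % 3 ≡ 0 → ∀ A B C D → ¬ IsSolution n A B C D
no-solutions n n%3≡0 A B C D (0<A , 0<B , 0<C , _ , A+B≡C , ABC≡Dⁿ) =
  ℕ.<⇒≢ (ℕ.*-mono-< (ℕ.*-mono-< 0<A 0<B) 0<C)
    (sym (cube-product-of-sum A B C (D ^ (n / 3)) A+B≡C (trans ABC≡Dⁿ (power-of-multiple-of-3 D n n%3≡0))))

theorem2 : (n : ℕ) → 3 ≤ n →
    ((n % 3 ≢ 0 → InfinitelyManySolutions n) ×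
     (n % 3 ≡ 0 → ∀ A B C D → ¬ IsSolution n A B C D))
theorem2 n _ = infinitely-many-solutions n , no-solutions n
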